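{- Let $\mathbf{Sym}$ be the algebra of noncommutative symmetric functions over $\mathbb{Q}$, let $\varphi=\log\sigma_1=\sum_{n\ge1}\varphi_n$, and define $Y=\sum_{n\ge1}Y_n:=\tanh(\varphi)$, where $Y_n$ is homogeneous of degree $n$. For $n\ge1$ and $1\le r\le n$ let $\mathcal{A}(n,r)=\sum_{I\vDash n,\ \ell(I)=r}R_I$. Then for every $n\ge1$, $$Y_n=-\frac1{2^n}\sum_{r=1}^n \operatorname{Re}\bigl(i^r(1+i)^{n+1}\bigr)\,\mathcal{A}(n,r),$$ where $i=\sqrt{ -1}$; equivalently, $$Y_n=-\left(\frac1{\sqrt2}\right)^{n-1}\sum_{I\vDash n}\cos\Bigl((n+1+2\ell(I))\frac{\pi}{4}\Bigr)\,R_I .$$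
   Context: $\mathbf{Sym}$ is the free associative algebra over $\mathbb{Q}$ on noncommuting generators $S_1,S_2,\dots$ (with $S_0=1$), graded by $\deg S_n=n$. For a composition $I=(i_1,\dots,i_r)$ of $n$ (written $I\vDash n$), put $S^I=S_{i_1}\cdots S_{i_r}$ and $\ell(I)=r$. The ribbon basis $(R_I)$ is defined by $S^I=\sum_J R_J$, the sum running over all compositions $J$ of $n$ that are coarser than or equal to $I$ (i.e. obtained from $I$ by adding together blocks of consecutive parts). $\sigma_1=\sum_{n\ge0}S_n$, $\varphi=\log\sigma_1$ (logarithm as a power series in the completed graded algebra), $\varphi_n$ its homogeneous component of degree $n$, and $\tanh(\varphi)=\sum_{m\ge1}c_m\varphi^m$ where $\tanh x=\sum_m c_m x^m$. For instance $Y_2=-\tfrac12R_{11}+\tfrac12R_2$ and $Y_3=-\tfrac12R_{12}-\tfrac12R_{21}$. -}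

module Defs where

open import Data.Nat as ℕ using (ℕ; zero; suc; _!)
open import Data.Nat.Properties using (_!≢0)
open import Data.Integer as ℤ using (ℤ; +_)
open import Data.Rational using (ℚ; 0ℚ; 1ℚ; _+_; _*_; -_; _-_; _/_)
open import Data.List using (List; []; _∷_; [_]; map; concatMap; length; foldr; _++_)
open import Data.List.Properties using (≡-dec)
open import Data.Product using (_×_; _,_)
open import Data.Bool using (Bool; true; false; if_then_else_)
open import Relation.Nullary using (does)
open import Relation.Binary.PropositionalEquality using (_≡_)

-- The letter k : ℕ stands for
-- the generator S_(suc k).  A word I = (i_1,...,i_r) is identified with
-- the composition (i_1,...,i_r) (parts i_j = suc k_j); S^I is its monomial.

Word : Set
Word = List ℕ

deg : Word → ℕ
deg [] = 0
deg (k ∷ w) = suc k ℕ.+ deg w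

-- The completed graded algebra Q<<S_1,S_2,...>> (completion of Sym):
-- an element is given by its coefficient on each monomial S^I.

Series : Set
Series = Word → ℚ

_≈_ : Series → Series → Set
f ≈ g = ∀ w → f w ≡ g w

infix 4 _≈_

zeroS : Series
zeroS _ = 0ℚ

oneS : Series
oneS [] = 1ℚ
oneS (_ ∷ _) = 0ℚ

S^ : Word → Series
S^ I w = if does (≡-dec ℕ._≟_ I w) then 1ℚ else 0ℚ

_+S_ : Series → Series → Series
(f +S g) w = f w + g w

_-S_ : Series → Series → Series
(f -S g) w = f w - g w

_·S_ : ℚ → Series → Series
(c ·S f) w = c * f w

infixl 6 _+S_ _-S_
infixl 7 _·S_ _*S_

splits : Word → List (Word × Word)
splits [] = ([] , []) ∷ []
splits (a ∷ w) = ([] , a ∷ w) ∷ map (λ { (u , v) → (a ∷ u , v) }) (splits w)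

sumℚ : List ℚ → ℚ
sumℚ = foldr _+_ 0ℚ

_*S_ : Series → Series → Series
(f *S g) w = sumℚ (map (λ { (u , v) → f u * g v }) (splits w))

_^S_ : Series → ℕ → Series
f ^S zero = oneS
f ^S suc k = f *S (f ^S k)

sumS : List Series → Series
sumS = foldr _+S_ zeroS

component : ℕ → Series → Series
component n f w = if does (deg w ℕ.≟ n) then f w else 0ℚ

-- Substitution of x (with zero constant term, x(()) = 0) into a formal
-- power series  Σ_k a_k t^k :   Σ_k a_k x^k.  The coefficient of the
-- word w only receives contributions from k ≤ length w (each factor of
-- x consumes at least one letter), so the infinite sum is computed
-- exactly by truncating at k = length w.

sumUpTo : ℕ → (ℕ → ℚ) → ℚ
sumUpTo zero h = h 0
sumUpTo (suc n) h = sumUpTo n h + h (suc n)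

subst-series : (ℕ → ℚ) → Series → Series
subst-series a x w = sumUpTo (length w) (λ k → a k * (x ^S k) w)

sgn : ℕ → ℚ
sgn zero = 1ℚ
sgn (suc k) = - sgn k

invFact : ℕ → ℚ
invFact k = _/_ (+ 1) (k !) {{k !≢0}}

logCoeff : ℕ → ℚ
logCoeff zero = 0ℚ
logCoeff (suc k) = sgn k * (+ 1 / suc k)

isOdd : ℕ → Bool
isOdd zero = false
isOdd (suc k) = Data.Bool.not (isOdd k)

sinhCoeff : ℕ → ℚ
sinhCoeff k = if isOdd k then invFact k else 0ℚ

coshCoeff : ℕ → ℚ
coshCoeff k = if isOdd k then 0ℚ else invFact k

invCoeff : ℕ → ℚ
invCoeff = sgn

σ₁ : Series
σ₁ [] = 1ℚ
σ₁ (_ ∷ []) = 1ℚ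
σ₁ (_ ∷ _ ∷ _) = 0ℚ

φ : Series
φ = subst-series logCoeff (σ₁ -S oneS)

sinhφ : Series
sinhφ = subst-series sinhCoeff φ

coshφ : Series
coshφ = subst-series coshCoeff φ

coshφ⁻¹ : Series
coshφ⁻¹ = subst-series invCoeff (coshφ -S oneS)

Y : Series
Y = sinhφ *S coshφ⁻¹

Yₙ : ℕ → Series
Yₙ n = component n Y

compositions : ℕ → List Word
compositions zero = [] ∷ []
compositions (suc n) = map (0 ∷_) (compositions n) ++ concatMap incHead (compositions n)
  where
  incHead : Word → List Word
  incHead [] = []
  incHead (a ∷ w) = (suc a ∷ w) ∷ []

-- all compositions J coarser than or equal to I (obtained by adding
-- together blocks of consecutive parts)
coarsenings : Word → List Word
coarsenings [] = [] ∷ []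
coarsenings (a ∷ w) = concatMap ext (coarsenings w)
  where
  -- either keep part (suc a) separate, or merge it with the first part
  -- (suc j) of J, giving part suc a + suc j, i.e. letter suc (a + j)
  ext : Word → List Word
  ext [] = (a ∷ []) ∷ []
  ext (j ∷ J) = (a ∷ j ∷ J) ∷ (suc (a ℕ.+ j) ∷ J) ∷ []

IsRibbonBasis : (Word → Series) → Set
IsRibbonBasis R = ∀ I → S^ I ≈ sumS (map R (coarsenings I))

𝒜 : (Word → Series) → ℕ → ℕ → Series
𝒜 R n r = sumS (map (λ I → if does (length I ℕ.≟ r) then R I else zeroS) (compositions n))

record ℤ[i] : Set where
  constructor _+i_
  field re im : ℤ
open ℤ[i] public

_*G_ : ℤ[i] → ℤ[i] → ℤ[i]
(a +i b) *G (c +i d) = (a ℤ.* c ℤ.- b ℤ.* d) +i (a ℤ.* d ℤ.+ b ℤ.* c)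

_^G_ : ℤ[i] → ℕ → ℤ[i]
z ^G zero = (+ 1) +i (+ 0)
z ^G suc k = z *G (z ^G k)

iG : ℤ[i]
iG = (+ 0) +i (+ 1)

1+iG : ℤ[i]
1+iG = (+ 1) +i (+ 1)

ReCoeff : ℕ → ℕ → ℚ
ReCoeff n r = re ((iG ^G r) *G (1+iG ^G suc n)) / 1

inv2^ : ℕ → ℚ
inv2^ n = _/_ (+ 1) (2 ℕ.^ n) {{ℕ.>-nonZero (m^n>0 2 n)}}
  where open import Data.Nat.Properties using (m^n>0)

rhs : (Word → Series) → ℕ → Series
rhs R n = (- inv2^ n) ·S sumS (map (λ r → ReCoeff n (suc r) ·S 𝒜 R n (suc r)) (Data.List.upTo n))

-- sanity checks: Y_2 = -1/2 S^{11} + S^2  (i.e. -1/2 R_11 + 1/2 R_2)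
private
  test1 : Y (0 ∷ 0 ∷ []) ≡ - (+ 1 / 2)
  test1 = Relation.Binary.PropositionalEquality.refl
  test2 : Y (1 ∷ []) ≡ 1ℚ
  test2 = Relation.Binary.PropositionalEquality.refl
  test3 : Y (0 ∷ []) ≡ 1ℚ
  test3 = Relation.Binary.PropositionalEquality.refl

-- The k-th power of σ₁ − 1 = Σ S_k is the sum of the S^I with ℓ(I) = k, so every power series in
-- σ₁ − 1 has a coefficient on S^I that depends only on ℓ(I).  Hence the coefficient of S^I in
-- Y = tanh(log σ₁) is y_ℓ(I), where y = tanh(log(1+t)) = (t + t²/2)/(1 + t + t²/2) is a series in one
-- variable; the identities exp(± log(1+t)) = (1+t)^(±1) behind this follow from the Euler operator t d/dt.
-- Thus y_(k+2) + y_(k+1) + y_k/2 = 0, a recurrence also satisfied by c(k,k), where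
-- c(n,m) = −2^(−n) Re(i^m (1+i)^(n+1)), so y_k = c(k,k) for k ≥ 1.  Expanding S^I = Σ_(J≽I) R_J, the
-- coefficient of R_J in Y_n is Σ_(I≼J) y_ℓ(I) = Σ_j C(n−m, j) y_(m+j) with m = ℓ(J), and the Pascal rule
-- c(n+1,m) = c(n,m) + c(n+1,m+1) turns this binomial sum into c(n,m).

module Submission where

open import Defs
open import Function using (_∘_)
open import Level using (0ℓ)
open import Data.Bool using (Bool; true; false; if_then_else_)
open import Data.Empty using (⊥-elim)
open import Data.Product using (_×_; _,_; proj₁)
open import Data.Nat as ℕ
  using (ℕ; zero; suc; NonZero; _≤_; _<_; z≤n; s≤s; _≤′_; ≤′-refl; ≤′-step; _∸_; _!; _^_)
import Data.Nat.Properties as ℕ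
open import Data.Nat.Properties using (_!≢0)
open import Data.Integer as ℤ using (ℤ)
import Data.Integer.Properties as ℤ
import Data.Integer.Tactic.RingSolver as ℤ-Solver
open import Data.Rational using (ℚ; 0ℚ; 1ℚ; ½; _+_; _*_; -_; _-_; _/_; toℚᵘ)
import Data.Rational.Properties as ℚ
import Data.Rational.Unnormalised as ℚᵘ
import Data.Rational.Unnormalised.Properties as ℚᵘ
open import Data.List using (List; []; _∷_; map; length; _++_; concatMap; applyUpTo; upTo)
open import Data.List.Properties using (map-∘; map-cong; ≡-dec; ∷-injectiveʳ)
open import Relation.Nullary using (does; yes; no; ¬_)
open import Relation.Nullary.Decidable using (dec⇒maybe)
open import Relation.Binary.PropositionalEquality
open import Tactic.RingSolver using (solve-∀)
import Tactic.RingSolver.Core.AlmostCommutativeRing as ACR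

open ≡-Reasoning

-- Rational arithmetic

ℚ-ring : ACR.AlmostCommutativeRing 0ℓ 0ℓ
ℚ-ring = ACR.fromCommutativeRing ℚ.+-*-commutativeRing (λ x → dec⇒maybe (0ℚ ℚ.≟ x))

toℚᵘ-/ : ∀ a b .{{_ : NonZero b}} → toℚᵘ (a / b) ℚᵘ.≃ (a ℚᵘ./ b)
toℚᵘ-/ a (suc b) = ℚ.toℚᵘ-fromℚᵘ (ℚᵘ.mkℚᵘ a b)

/-≡ : ∀ a c b d .{{_ : NonZero b}} .{{_ : NonZero d}} → a ℤ.* ℤ.+ d ≡ c ℤ.* ℤ.+ b → a / b ≡ c / d
/-≡ a c b@(suc _) d@(suc _) eq =
  ℚ.toℚᵘ-injective (ℚᵘ.≃-trans (toℚᵘ-/ a b) (ℚᵘ.≃-trans (ℚᵘ.*≡* eq) (ℚᵘ.≃-sym (toℚᵘ-/ c d))))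

/-*-/ : ∀ a c b d .{{_ : NonZero b}} .{{_ : NonZero d}} →
        (a / b) * (c / d) ≡ _/_ (a ℤ.* c) (b ℕ.* d) {{ℕ.m*n≢0 b d}}
/-*-/ a c b@(suc _) d@(suc _) = ℚ.toℚᵘ-injective (ℚᵘ.≃-trans (ℚ.toℚᵘ-homo-* (a / b) (c / d))
  (ℚᵘ.≃-trans (ℚᵘ.*-cong (toℚᵘ-/ a b) (toℚᵘ-/ c d)) (ℚᵘ.≃-sym (toℚᵘ-/ (a ℤ.* c) (b ℕ.* d)))))

isolate : ∀ {a b c} → a + b ≡ c → a ≡ c - b
isolate {a} {b} refl = move a b
  where
  move : ∀ a b → a ≡ a + b - b
  move = solve-∀ ℚ-ring

fromℤ : ℤ → ℚ
fromℤ a = a / 1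

fromℕ : ℕ → ℚ
fromℕ n = fromℤ (ℤ.+ n)

fromℤ-+ : ∀ a c → fromℤ (a ℤ.+ c) ≡ fromℤ a + fromℤ c
fromℤ-+ a c = ℚ.toℚᵘ-injective (ℚᵘ.≃-trans (toℚᵘ-/ (a ℤ.+ c) 1)
  (ℚᵘ.≃-trans (ℚᵘ.*≡* (eq a c)) (ℚᵘ.≃-sym (ℚᵘ.≃-trans (ℚ.toℚᵘ-homo-+ (fromℤ a) (fromℤ c))
    (ℚᵘ.+-cong (toℚᵘ-/ a 1) (toℚᵘ-/ c 1))))))
  where
  eq : ∀ a c → (a ℤ.+ c) ℤ.* ℤ.+ 1 ≡ (a ℤ.* ℤ.+ 1 ℤ.+ c ℤ.* ℤ.+ 1) ℤ.* ℤ.+ 1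
  eq = ℤ-Solver.solve-∀

fromℤ-* : ∀ a c → fromℤ (a ℤ.* c) ≡ fromℤ a * fromℤ c
fromℤ-* a c = sym (/-*-/ a c 1 1)

fromℕ-suc : ∀ n → fromℕ (suc n) ≡ fromℕ n + 1ℚ
fromℕ-suc n = trans (fromℤ-+ (ℤ.+ 1) (ℤ.+ n)) (ℚ.+-comm 1ℚ (fromℕ n))

fromℕ-*-1/ : ∀ k → fromℕ (suc k) * (ℤ.+ 1 / suc k) ≡ 1ℚ
fromℕ-*-1/ k = trans (/-*-/ (ℤ.+ suc k) (ℤ.+ 1) 1 (suc k))
  (/-≡ (ℤ.+ suc k ℤ.* ℤ.+ 1) (ℤ.+ 1) (1 ℕ.* suc k) 1 cross)
  where
  cross : ℤ.+ suc k ℤ.* ℤ.+ 1 ℤ.* ℤ.+ 1 ≡ ℤ.+ 1 ℤ.* ℤ.+ (1 ℕ.* suc k)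
  cross = trans (unit (ℤ.+ suc k)) (cong (ℤ.+ 1 ℤ.*_) (sym (ℤ.pos-* 1 (suc k))))
    where
    unit : ∀ x → x ℤ.* ℤ.+ 1 ℤ.* ℤ.+ 1 ≡ ℤ.+ 1 ℤ.* (ℤ.+ 1 ℤ.* x)
    unit = ℤ-Solver.solve-∀

1/-*-cancel : ∀ m n .{{_ : NonZero m}} .{{_ : NonZero n}} →
              _/_ (ℤ.+ 1) (m ℕ.* n) {{ℕ.m*n≢0 m n}} * fromℕ m ≡ ℤ.+ 1 / n
1/-*-cancel m n = trans (/-*-/ (ℤ.+ 1) (ℤ.+ m) (m ℕ.* n) 1 {{ℕ.m*n≢0 m n}})
  (/-≡ (ℤ.+ 1 ℤ.* ℤ.+ m) (ℤ.+ 1) (m ℕ.* n ℕ.* 1) n {{ℕ.m*n≢0 (m ℕ.* n) 1 {{ℕ.m*n≢0 m n}}}} cross)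
  where
  cross : ℤ.+ 1 ℤ.* ℤ.+ m ℤ.* ℤ.+ n ≡ ℤ.+ 1 ℤ.* ℤ.+ (m ℕ.* n ℕ.* 1)
  cross = trans (reassoc (ℤ.+ m) (ℤ.+ n))
    (cong (ℤ.+ 1 ℤ.*_) (sym (trans (ℤ.pos-* (m ℕ.* n) 1) (cong (ℤ._* ℤ.+ 1) (ℤ.pos-* m n)))))
    where
    reassoc : ∀ x y → ℤ.+ 1 ℤ.* x ℤ.* y ≡ ℤ.+ 1 ℤ.* (x ℤ.* y ℤ.* ℤ.+ 1)
    reassoc = ℤ-Solver.solve-∀

invFact-suc : ∀ j → invFact (suc j) * fromℕ (suc j) ≡ invFact j
invFact-suc j = 1/-*-cancel (suc j) (j !) {{_}} {{j !≢0}}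

inv2^-suc : ∀ n → inv2^ (suc n) * fromℕ 2 ≡ inv2^ n
inv2^-suc n = 1/-*-cancel 2 (2 ^ n) {{_}} {{ℕ.>-nonZero (ℕ.m^n>0 2 n)}}

-- Formal power series in one variable

PowerSeries : Set
PowerSeries = ℕ → ℚ

infix 4 _≐_
_≐_ : PowerSeries → PowerSeries → Set
F ≐ G = ∀ n → F n ≡ G n

0ₚ 1ₚ : PowerSeries
0ₚ _ = 0ℚ
1ₚ zero = 1ℚ
1ₚ (suc _) = 0ℚ

infixl 6 _+ₚ_
infixl 7 _·ₚ_ _⊛_

_+ₚ_ : PowerSeries → PowerSeries → PowerSeries
(F +ₚ G) n = F n + G n

_·ₚ_ : ℚ → PowerSeries → PowerSeries
(c ·ₚ F) n = c * F n

tail : PowerSeries → PowerSeries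
tail F k = F (suc k)

shift : PowerSeries → PowerSeries
shift F zero = 0ℚ
shift F (suc k) = F k

_⊛_ : PowerSeries → PowerSeries → PowerSeries
(F ⊛ G) zero = F 0 * G 0
(F ⊛ G) (suc n) = F 0 * G (suc n) + (tail F ⊛ G) n

⊛-cong : ∀ {F F′ G G′} → F ≐ F′ → G ≐ G′ → F ⊛ G ≐ F′ ⊛ G′
⊛-cong f g zero = cong₂ _*_ (f 0) (g 0)
⊛-cong f g (suc n) = cong₂ _+_ (cong₂ _*_ (f 0) (g (suc n))) (⊛-cong (λ k → f (suc k)) g n)

⊛-congʳ-≤ : ∀ n {F G G′} → (∀ p → p ≤ n → G p ≡ G′ p) → (F ⊛ G) n ≡ (F ⊛ G′) n
⊛-congʳ-≤ zero {F} eq = cong (F 0 *_) (eq 0 z≤n)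
⊛-congʳ-≤ (suc n) {F} eq = cong₂ _+_ (cong (F 0 *_) (eq (suc n) ℕ.≤-refl))
  (⊛-congʳ-≤ n {tail F} (λ p p≤n → eq p (ℕ.m≤n⇒m≤1+n p≤n)))

⊛-distribˡ : ∀ F G H → F ⊛ (G +ₚ H) ≐ F ⊛ G +ₚ F ⊛ H
⊛-distribˡ F G H zero = ℚ.*-distribˡ-+ (F 0) (G 0) (H 0)
⊛-distribˡ F G H (suc n) = begin
  F 0 * (G (suc n) + H (suc n)) + (tail F ⊛ (G +ₚ H)) n
    ≡⟨ cong (F 0 * (G (suc n) + H (suc n)) +_) (⊛-distribˡ (tail F) G H n) ⟩
  F 0 * (G (suc n) + H (suc n)) + ((tail F ⊛ G) n + (tail F ⊛ H) n)
    ≡⟨ rearrange (F 0) (G (suc n)) (H (suc n)) _ _ ⟩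
  (F ⊛ G) (suc n) + (F ⊛ H) (suc n) ∎
  where
  rearrange : ∀ a b c x y → a * (b + c) + (x + y) ≡ a * b + x + (a * c + y)
  rearrange = solve-∀ ℚ-ring

⊛-distribʳ : ∀ F G H → (F +ₚ G) ⊛ H ≐ F ⊛ H +ₚ G ⊛ H
⊛-distribʳ F G H zero = ℚ.*-distribʳ-+ (H 0) (F 0) (G 0)
⊛-distribʳ F G H (suc n) = begin
  (F 0 + G 0) * H (suc n) + ((tail F +ₚ tail G) ⊛ H) n
    ≡⟨ cong ((F 0 + G 0) * H (suc n) +_) (⊛-distribʳ (tail F) (tail G) H n) ⟩
  (F 0 + G 0) * H (suc n) + ((tail F ⊛ H) n + (tail G ⊛ H) n)
    ≡⟨ rearrange (F 0) (G 0) (H (suc n)) _ _ ⟩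
  (F ⊛ H) (suc n) + (G ⊛ H) (suc n) ∎
  where
  rearrange : ∀ a b c x y → (a + b) * c + (x + y) ≡ a * c + x + (b * c + y)
  rearrange = solve-∀ ℚ-ring

⊛-·ˡ : ∀ c F G → (c ·ₚ F) ⊛ G ≐ c ·ₚ (F ⊛ G)
⊛-·ˡ c F G zero = ℚ.*-assoc c (F 0) (G 0)
⊛-·ˡ c F G (suc n) = trans (cong (c * F 0 * G (suc n) +_) (⊛-·ˡ c (tail F) G n))
  (rearrange c (F 0) (G (suc n)) _)
  where
  rearrange : ∀ c a b x → c * a * b + c * x ≡ c * (a * b + x)
  rearrange = solve-∀ ℚ-ring

⊛-·ʳ : ∀ c F G → F ⊛ (c ·ₚ G) ≐ c ·ₚ (F ⊛ G)
⊛-·ʳ c F G zero = rearrange (F 0) c (G 0)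
  where
  rearrange : ∀ a c b → a * (c * b) ≡ c * (a * b)
  rearrange = solve-∀ ℚ-ring
⊛-·ʳ c F G (suc n) = trans (cong (F 0 * (c * G (suc n)) +_) (⊛-·ʳ c (tail F) G n))
  (rearrange (F 0) c (G (suc n)) _)
  where
  rearrange : ∀ a c b x → a * (c * b) + c * x ≡ c * (a * b + x)
  rearrange = solve-∀ ℚ-ring

⊛-zeroˡ : ∀ {F} G → F ≐ 0ₚ → F ⊛ G ≐ 0ₚ
⊛-zeroˡ {F} G F≐0 zero = trans (cong (_* G 0) (F≐0 0)) (ℚ.*-zeroˡ (G 0))
⊛-zeroˡ {F} G F≐0 (suc n) = cong₂ _+_ (trans (cong (_* G (suc n)) (F≐0 0)) (ℚ.*-zeroˡ (G (suc n))))
  (⊛-zeroˡ G (λ k → F≐0 (suc k)) n)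

⊛-identityˡ : ∀ G → 1ₚ ⊛ G ≐ G
⊛-identityˡ G zero = ℚ.*-identityˡ (G 0)
⊛-identityˡ G (suc n) = trans (cong₂ _+_ (ℚ.*-identityˡ (G (suc n))) (⊛-zeroˡ G (λ _ → refl) n))
  (ℚ.+-identityʳ (G (suc n)))

⊛-suc-last : ∀ n F G → (F ⊛ G) (suc n) ≡ (F ⊛ tail G) n + F (suc n) * G 0
⊛-suc-last zero F G = refl
⊛-suc-last (suc n) F G = trans (cong (F 0 * G (suc (suc n)) +_) (⊛-suc-last n (tail F) G))
  (sym (ℚ.+-assoc (F 0 * G (suc (suc n))) _ _))

⊛-comm : ∀ F G → F ⊛ G ≐ G ⊛ F
⊛-comm F G zero = ℚ.*-comm (F 0) (G 0)
⊛-comm F G (suc n) = begin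
  F 0 * G (suc n) + (tail F ⊛ G) n  ≡⟨ cong (F 0 * G (suc n) +_) (⊛-comm (tail F) G n) ⟩
  F 0 * G (suc n) + (G ⊛ tail F) n  ≡⟨ rearrange (F 0) (G (suc n)) _ ⟩
  (G ⊛ tail F) n + G (suc n) * F 0  ≡⟨ ⊛-suc-last n G F ⟨
  (G ⊛ F) (suc n)                   ∎
  where
  rearrange : ∀ a b x → a * b + x ≡ x + b * a
  rearrange = solve-∀ ℚ-ring

⊛-assoc : ∀ F G H → (F ⊛ G) ⊛ H ≐ F ⊛ (G ⊛ H)
⊛-assoc F G H zero = ℚ.*-assoc (F 0) (G 0) (H 0)
⊛-assoc F G H (suc n) = begin
  F 0 * G 0 * H (suc n) + ((F 0 ·ₚ tail G +ₚ tail F ⊛ G) ⊛ H) n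
    ≡⟨ cong (F 0 * G 0 * H (suc n) +_) (⊛-distribʳ (F 0 ·ₚ tail G) (tail F ⊛ G) H n) ⟩
  F 0 * G 0 * H (suc n) + (((F 0 ·ₚ tail G) ⊛ H) n + ((tail F ⊛ G) ⊛ H) n)
    ≡⟨ cong₂ (λ x y → F 0 * G 0 * H (suc n) + (x + y)) (⊛-·ˡ (F 0) (tail G) H n) (⊛-assoc (tail F) G H n) ⟩
  F 0 * G 0 * H (suc n) + (F 0 * (tail G ⊛ H) n + (tail F ⊛ (G ⊛ H)) n)
    ≡⟨ rearrange (F 0) (G 0) (H (suc n)) _ _ ⟩
  (F ⊛ (G ⊛ H)) (suc n) ∎
  where
  rearrange : ∀ a b c x z → a * b * c + (a * x + z) ≡ a * (b * c + x) + z
  rearrange = solve-∀ ℚ-ring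

⊛-vanishes : ∀ m F G → (∀ i → i ≤ m → G i ≡ 0ℚ) → (F ⊛ G) m ≡ 0ℚ
⊛-vanishes zero F G G≡0 = trans (cong (F 0 *_) (G≡0 0 z≤n)) (ℚ.*-zeroʳ (F 0))
⊛-vanishes (suc m) F G G≡0 = cong₂ _+_ (trans (cong (F 0 *_) (G≡0 (suc m) ℕ.≤-refl)) (ℚ.*-zeroʳ (F 0)))
  (⊛-vanishes m (tail F) G (λ i i≤m → G≡0 i (ℕ.m≤n⇒m≤1+n i≤m)))

⊛-identityʳ : ∀ F → F ⊛ 1ₚ ≐ F
⊛-identityʳ F n = trans (⊛-comm F 1ₚ n) (⊛-identityˡ F n)

shift-⊛ : ∀ F G → shift F ⊛ G ≐ shift (F ⊛ G)
shift-⊛ F G zero = ℚ.*-zeroˡ (G 0)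
shift-⊛ F G (suc n) = trans (cong (_+ (F ⊛ G) n) (ℚ.*-zeroˡ (G (suc n)))) (ℚ.+-identityˡ ((F ⊛ G) n))

infixr 8 _^ₚ_
_^ₚ_ : PowerSeries → ℕ → PowerSeries
F ^ₚ zero = 1ₚ
F ^ₚ suc k = F ⊛ F ^ₚ k

^ₚ-vanishes : ∀ {F} → F 0 ≡ 0ℚ → ∀ k n → n < k → (F ^ₚ k) n ≡ 0ℚ
^ₚ-vanishes {F} F₀≡0 (suc k) zero _ = trans (cong (_* (F ^ₚ k) 0) F₀≡0) (ℚ.*-zeroˡ ((F ^ₚ k) 0))
^ₚ-vanishes {F} F₀≡0 (suc k) (suc n) (s≤s n<k) =
  cong₂ _+_ (trans (cong (_* (F ^ₚ k) (suc n)) F₀≡0) (ℚ.*-zeroˡ ((F ^ₚ k) (suc n))))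
    (⊛-vanishes n (tail F) (F ^ₚ k) (λ i i≤n → ^ₚ-vanishes F₀≡0 k i (ℕ.≤-<-trans i≤n n<k)))

sumUpTo-cong : ∀ N {f g} → (∀ k → f k ≡ g k) → sumUpTo N f ≡ sumUpTo N g
sumUpTo-cong zero f≡g = f≡g 0
sumUpTo-cong (suc N) f≡g = cong₂ _+_ (sumUpTo-cong N f≡g) (f≡g (suc N))

*-sumUpTo : ∀ N c f → c * sumUpTo N f ≡ sumUpTo N (λ k → c * f k)
*-sumUpTo zero c f = refl
*-sumUpTo (suc N) c f = trans (ℚ.*-distribˡ-+ c (sumUpTo N f) (f (suc N)))
  (cong (_+ c * f (suc N)) (*-sumUpTo N c f))

sumUpTo-suc : ∀ N f → sumUpTo (suc N) f ≡ f 0 + sumUpTo N (λ k → f (suc k))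
sumUpTo-suc zero f = refl
sumUpTo-suc (suc N) f = trans (cong (_+ f (suc (suc N))) (sumUpTo-suc N f)) (ℚ.+-assoc (f 0) _ _)

sumUpTo-zero : ∀ N f → (∀ k → k ≤ N → f k ≡ 0ℚ) → sumUpTo N f ≡ 0ℚ
sumUpTo-zero zero f f≡0 = f≡0 0 z≤n
sumUpTo-zero (suc N) f f≡0 =
  cong₂ _+_ (sumUpTo-zero N f (λ k k≤N → f≡0 k (ℕ.m≤n⇒m≤1+n k≤N))) (f≡0 (suc N) ℕ.≤-refl)

⊛-sumUpTo : ∀ N H (c : ℕ → ℚ) (P : ℕ → PowerSeries) →
  H ⊛ (λ m → sumUpTo N (λ j → c j * P j m)) ≐ (λ n → sumUpTo N (λ j → c j * (H ⊛ P j) n))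
⊛-sumUpTo zero H c P = ⊛-·ʳ (c 0) H (P 0)
⊛-sumUpTo (suc N) H c P n = trans (⊛-distribˡ H (λ m → sumUpTo N (λ j → c j * P j m)) (c (suc N) ·ₚ P (suc N)) n)
  (cong₂ _+_ (⊛-sumUpTo N H c P n) (⊛-·ʳ (c (suc N)) H (P (suc N)) n))

composeUpTo : ℕ → PowerSeries → PowerSeries → PowerSeries
composeUpTo N a F n = sumUpTo N (λ k → a k * (F ^ₚ k) n)

-- Truncating at k ≤ n gives the coefficient of a(F(t)) only when F 0 ≡ 0 (composeUpTo-stable).
infixr 9 _∘ₚ_
_∘ₚ_ : PowerSeries → PowerSeries → PowerSeries
(a ∘ₚ F) n = composeUpTo n a F n

composeUpTo-stable : ∀ {F} → F 0 ≡ 0ℚ → ∀ a N n → n ≤ N → composeUpTo N a F n ≡ (a ∘ₚ F) n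
composeUpTo-stable {F} F₀≡0 a N n n≤N = go N (ℕ.≤⇒≤′ n≤N)
  where
  go : ∀ N → n ≤′ N → composeUpTo N a F n ≡ (a ∘ₚ F) n
  go N ≤′-refl = refl
  go (suc N) (≤′-step n≤′N) = begin
    composeUpTo N a F n + a (suc N) * (F ^ₚ suc N) n
      ≡⟨ cong (λ x → composeUpTo N a F n + a (suc N) * x)
           (^ₚ-vanishes F₀≡0 (suc N) n (s≤s (ℕ.≤′⇒≤ n≤′N))) ⟩
    composeUpTo N a F n + a (suc N) * 0ℚ
      ≡⟨ cong (composeUpTo N a F n +_) (ℚ.*-zeroʳ (a (suc N))) ⟩
    composeUpTo N a F n + 0ℚ
      ≡⟨ ℚ.+-identityʳ _ ⟩
    composeUpTo N a F n
      ≡⟨ go N n≤′N ⟩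
    (a ∘ₚ F) n ∎

∘ₚ-cong : ∀ {a b} F → a ≐ b → a ∘ₚ F ≐ b ∘ₚ F
∘ₚ-cong F a≐b n = sumUpTo-cong n (λ k → cong (_* (F ^ₚ k) n) (a≐b k))

∘ₚ-linear : ∀ α β a b F → (α ·ₚ a +ₚ β ·ₚ b) ∘ₚ F ≐ α ·ₚ (a ∘ₚ F) +ₚ β ·ₚ (b ∘ₚ F)
∘ₚ-linear α β a b F n = go n
  where
  go : ∀ N → composeUpTo N (α ·ₚ a +ₚ β ·ₚ b) F n ≡ α * composeUpTo N a F n + β * composeUpTo N b F n
  go zero = distrib α β (a 0) (b 0) _
    where
    distrib : ∀ α β a b p → (α * a + β * b) * p ≡ α * (a * p) + β * (b * p)
    distrib = solve-∀ ℚ-ring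
  go (suc N) = trans (cong (_+ (α * a (suc N) + β * b (suc N)) * (F ^ₚ suc N) n) (go N))
    (distrib α β (a (suc N)) (b (suc N)) _ _ _)
    where
    distrib : ∀ α β a b p X Y → α * X + β * Y + (α * a + β * b) * p ≡ α * (X + a * p) + β * (Y + b * p)
    distrib = solve-∀ ℚ-ring

-- The Euler operator t d/dt and composition

euler : PowerSeries → PowerSeries
euler F n = fromℕ n * F n

tail-euler : ∀ F → tail (euler F) ≐ euler (tail F) +ₚ tail F
tail-euler F n = trans (cong (_* F (suc n)) (fromℕ-suc n)) (distrib (fromℕ n) (F (suc n)))
  where
  distrib : ∀ q x → (q + 1ℚ) * x ≡ q * x + x
  distrib = solve-∀ ℚ-ring

euler-⊛ : ∀ F G → euler (F ⊛ G) ≐ euler F ⊛ G +ₚ F ⊛ euler G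
euler-⊛ F G zero = leibniz₀ (F 0) (G 0)
  where
  leibniz₀ : ∀ a b → 0ℚ * (a * b) ≡ 0ℚ * a * b + a * (0ℚ * b)
  leibniz₀ = solve-∀ ℚ-ring
euler-⊛ F G (suc n) = sym (begin
  0ℚ * F 0 * G (suc n) + (tail (euler F) ⊛ G) n + (F 0 * euler G (suc n) + (tail F ⊛ euler G) n)
    ≡⟨ cong (λ x → 0ℚ * F 0 * G (suc n) + x + (F 0 * euler G (suc n) + (tail F ⊛ euler G) n))
         (trans (⊛-cong (tail-euler F) (λ _ → refl) n) (⊛-distribʳ (euler (tail F)) (tail F) G n)) ⟩
  0ℚ * F 0 * G (suc n) + ((euler (tail F) ⊛ G) n + (tail F ⊛ G) n) + (F 0 * euler G (suc n) + (tail F ⊛ euler G) n)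
    ≡⟨ rearrange (F 0) (G (suc n)) (euler G (suc n))
         ((euler (tail F) ⊛ G) n) ((tail F ⊛ G) n) ((tail F ⊛ euler G) n) ⟩
  F 0 * euler G (suc n) + (tail F ⊛ G) n + ((euler (tail F) ⊛ G) n + (tail F ⊛ euler G) n)
    ≡⟨ cong₂ (λ q x → F 0 * (q * G (suc n)) + (tail F ⊛ G) n + x) (fromℕ-suc n) (sym (euler-⊛ (tail F) G n)) ⟩
  F 0 * ((fromℕ n + 1ℚ) * G (suc n)) + (tail F ⊛ G) n + fromℕ n * (tail F ⊛ G) n
    ≡⟨ collect (fromℕ n) (F 0) (G (suc n)) ((tail F ⊛ G) n) ⟩
  (fromℕ n + 1ℚ) * (F ⊛ G) (suc n)
    ≡⟨ cong (_* (F ⊛ G) (suc n)) (fromℕ-suc n) ⟨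
  euler (F ⊛ G) (suc n) ∎)
  where
  rearrange : ∀ a b b′ x y z → 0ℚ * a * b + (x + y) + (a * b′ + z) ≡ a * b′ + y + (x + z)
  rearrange = solve-∀ ℚ-ring
  collect : ∀ q a b x → a * ((q + 1ℚ) * b) + x + q * x ≡ (q + 1ℚ) * (a * b + x)
  collect = solve-∀ ℚ-ring

euler-1ₚ : euler 1ₚ ≐ 0ₚ
euler-1ₚ zero = refl
euler-1ₚ (suc n) = ℚ.*-zeroʳ (fromℕ (suc n))

euler-^ₚ : ∀ F k → euler (F ^ₚ suc k) ≐ fromℕ (suc k) ·ₚ (euler F ⊛ F ^ₚ k)
euler-^ₚ F zero n = begin
  euler (F ⊛ 1ₚ) n                          ≡⟨ euler-⊛ F 1ₚ n ⟩
  (euler F ⊛ 1ₚ) n + (F ⊛ euler 1ₚ) n       ≡⟨ cong ((euler F ⊛ 1ₚ) n +_)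
                                                  (trans (⊛-comm F (euler 1ₚ) n) (⊛-zeroˡ F euler-1ₚ n)) ⟩
  (euler F ⊛ 1ₚ) n + 0ℚ                     ≡⟨ ℚ.+-identityʳ _ ⟩
  (euler F ⊛ 1ₚ) n                          ≡⟨ ℚ.*-identityˡ _ ⟨
  1ℚ * (euler F ⊛ 1ₚ) n                     ∎
euler-^ₚ F (suc k) n = begin
  euler (F ⊛ F ^ₚ suc k) n
    ≡⟨ euler-⊛ F (F ^ₚ suc k) n ⟩
  A + (F ⊛ euler (F ^ₚ suc k)) n
    ≡⟨ cong (A +_) (trans (⊛-cong (λ _ → refl) (euler-^ₚ F k) n) (⊛-·ʳ (fromℕ (suc k)) F _ n)) ⟩
  A + fromℕ (suc k) * (F ⊛ (euler F ⊛ F ^ₚ k)) n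
    ≡⟨ cong (λ x → A + fromℕ (suc k) * x) (⊛-swap n) ⟩
  A + fromℕ (suc k) * A
    ≡⟨ cong (λ q → A + q * A) (fromℕ-suc k) ⟩
  A + (fromℕ k + 1ℚ) * A
    ≡⟨ collect (fromℕ k) A ⟩
  (fromℕ k + 1ℚ + 1ℚ) * A
    ≡⟨ cong (_* A) (trans (fromℕ-suc (suc k)) (cong (_+ 1ℚ) (fromℕ-suc k))) ⟨
  fromℕ (suc (suc k)) * A ∎
  where
  A : ℚ
  A = (euler F ⊛ F ^ₚ suc k) n
  collect : ∀ q a → a + (q + 1ℚ) * a ≡ (q + 1ℚ + 1ℚ) * a
  collect = solve-∀ ℚ-ring
  ⊛-swap : F ⊛ (euler F ⊛ F ^ₚ k) ≐ euler F ⊛ F ^ₚ suc k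
  ⊛-swap m = trans (sym (⊛-assoc F (euler F) (F ^ₚ k) m))
    (trans (⊛-cong (⊛-comm F (euler F)) (λ _ → refl) m) (⊛-assoc (euler F) F (F ^ₚ k) m))

deriv : PowerSeries → PowerSeries
deriv a j = a (suc j) * fromℕ (suc j)

euler-composeUpTo : ∀ N a F → euler (composeUpTo (suc N) a F) ≐ euler F ⊛ composeUpTo N (deriv a) F
euler-composeUpTo N a F n = begin
  fromℕ n * sumUpTo (suc N) (λ k → a k * (F ^ₚ k) n)
    ≡⟨ *-sumUpTo (suc N) (fromℕ n) _ ⟩
  sumUpTo (suc N) (λ k → fromℕ n * (a k * (F ^ₚ k) n))
    ≡⟨ sumUpTo-suc N _ ⟩
  fromℕ n * (a 0 * 1ₚ n) + sumUpTo N (λ j → fromℕ n * (a (suc j) * (F ^ₚ suc j) n))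
    ≡⟨ cong₂ _+_ constant-term (sumUpTo-cong N higher-terms) ⟩
  0ℚ + sumUpTo N (λ j → deriv a j * (euler F ⊛ F ^ₚ j) n)
    ≡⟨ ℚ.+-identityˡ _ ⟩
  sumUpTo N (λ j → deriv a j * (euler F ⊛ F ^ₚ j) n)
    ≡⟨ ⊛-sumUpTo N (euler F) (deriv a) (F ^ₚ_) n ⟨
  (euler F ⊛ composeUpTo N (deriv a) F) n ∎
  where
  swap : ∀ a b c → a * (b * c) ≡ b * (a * c)
  swap = solve-∀ ℚ-ring
  constant-term : fromℕ n * (a 0 * 1ₚ n) ≡ 0ℚ
  constant-term = trans (swap (fromℕ n) (a 0) (1ₚ n)) (trans (cong (a 0 *_) (euler-1ₚ n)) (ℚ.*-zeroʳ (a 0)))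
  higher-terms : ∀ j → fromℕ n * (a (suc j) * (F ^ₚ suc j) n) ≡ deriv a j * (euler F ⊛ F ^ₚ j) n
  higher-terms j = trans (swap (fromℕ n) (a (suc j)) _)
    (trans (cong (a (suc j) *_) (euler-^ₚ F j n)) (sym (ℚ.*-assoc (a (suc j)) (fromℕ (suc j)) _)))

euler-∘ₚ : ∀ {F} → F 0 ≡ 0ℚ → ∀ a c → deriv a ≐ c ·ₚ a →
           euler (a ∘ₚ F) ≐ c ·ₚ (euler F ⊛ a ∘ₚ F)
euler-∘ₚ {F} F₀≡0 a c a′≐ca n = begin
  fromℕ n * composeUpTo n a F n
    ≡⟨ cong (fromℕ n *_) (composeUpTo-stable F₀≡0 a (suc n) n (ℕ.n≤1+n n)) ⟨
  euler (composeUpTo (suc n) a F) n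
    ≡⟨ euler-composeUpTo n a F n ⟩
  (euler F ⊛ composeUpTo n (deriv a) F) n
    ≡⟨ ⊛-cong (λ _ → refl) composeUpTo-deriv n ⟩
  (euler F ⊛ (c ·ₚ composeUpTo n a F)) n
    ≡⟨ ⊛-·ʳ c (euler F) (composeUpTo n a F) n ⟩
  c * (euler F ⊛ composeUpTo n a F) n
    ≡⟨ cong (c *_) (⊛-congʳ-≤ n (λ p p≤n → composeUpTo-stable F₀≡0 a n p p≤n)) ⟩
  c * (euler F ⊛ a ∘ₚ F) n ∎
  where
  composeUpTo-deriv : composeUpTo n (deriv a) F ≐ c ·ₚ composeUpTo n a F
  composeUpTo-deriv m = trans (sumUpTo-cong n (λ j → trans (cong (_* (F ^ₚ j) m) (a′≐ca j)) (ℚ.*-assoc c (a j) _)))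
    (sym (*-sumUpTo n c _))

-- exp, sinh, cosh and tanh of log(1+t)

t : PowerSeries
t = shift 1ₚ

⊛-t : ∀ G → t ⊛ G ≐ shift G
⊛-t G zero = shift-⊛ 1ₚ G zero
⊛-t G (suc n) = trans (shift-⊛ 1ₚ G (suc n)) (⊛-identityˡ G n)

t^ₚ-diagonal : ∀ n → (t ^ₚ n) n ≡ 1ℚ
t^ₚ-diagonal zero = refl
t^ₚ-diagonal (suc n) = trans (⊛-t (t ^ₚ n) (suc n)) (t^ₚ-diagonal n)

t^ₚ-below : ∀ k n → k < n → (t ^ₚ k) n ≡ 0ℚ
t^ₚ-below zero (suc n) _ = refl
t^ₚ-below (suc k) (suc n) (s≤s k<n) = trans (⊛-t (t ^ₚ k) (suc n)) (t^ₚ-below k n k<n)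

∘ₚ-t : ∀ a → a ∘ₚ t ≐ a
∘ₚ-t a zero = ℚ.*-identityʳ (a 0)
∘ₚ-t a (suc n) = begin
  sumUpTo n (λ k → a k * (t ^ₚ k) (suc n)) + a (suc n) * (t ^ₚ suc n) (suc n)
    ≡⟨ cong₂ _+_ (sumUpTo-zero n _ (λ k k≤n → trans (cong (a k *_) (t^ₚ-below k (suc n) (s≤s k≤n)))
                                                     (ℚ.*-zeroʳ (a k))))
                 (cong (a (suc n) *_) (t^ₚ-diagonal (suc n))) ⟩
  0ℚ + a (suc n) * 1ℚ
    ≡⟨ trans (ℚ.+-identityˡ _) (ℚ.*-identityʳ (a (suc n))) ⟩
  a (suc n) ∎

1+t : PowerSeries
1+t = 1ₚ +ₚ t

1+t-⊛ : ∀ H → 1+t ⊛ H ≐ H +ₚ shift H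
1+t-⊛ H n = trans (⊛-distribʳ 1ₚ t H n) (cong₂ _+_ (⊛-identityˡ H n) (⊛-t H n))

1+t-⊛-sgn : 1+t ⊛ sgn ≐ 1ₚ
1+t-⊛-sgn zero = refl
1+t-⊛-sgn (suc n) = trans (1+t-⊛ sgn (suc n)) (ℚ.+-inverseˡ (sgn n))

euler-log : euler logCoeff ≐ shift sgn
euler-log zero = refl
euler-log (suc k) = trans (swap (fromℕ (suc k)) (sgn k) (ℤ.+ 1 / suc k))
  (trans (cong (sgn k *_) (fromℕ-*-1/ k)) (ℚ.*-identityʳ (sgn k)))
  where
  swap : ∀ q s i → q * (s * i) ≡ s * (q * i)
  swap = solve-∀ ℚ-ring

fromℕ-suc-*-cancel : ∀ k {x y} → fromℕ (suc k) * x ≡ fromℕ (suc k) * y → x ≡ y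
fromℕ-suc-*-cancel k {x} {y} eq = begin
  x                       ≡⟨ cancel x ⟨
  fromℕ (suc k) * x * r   ≡⟨ cong (_* r) eq ⟩
  fromℕ (suc k) * y * r   ≡⟨ cancel y ⟩
  y                       ∎
  where
  r : ℚ
  r = ℤ.+ 1 / suc k
  cancel : ∀ z → fromℕ (suc k) * z * r ≡ z
  cancel z = trans (swap (fromℕ (suc k)) z r) (trans (cong (z *_) (fromℕ-*-1/ k)) (ℚ.*-identityʳ z))
    where
    swap : ∀ q z r → q * z * r ≡ z * (q * r)
    swap = solve-∀ ℚ-ring

-- For E = a(log(1+t)) with a′ = c a, this is the coefficientwise form of (1+t) t E′ = c t E.
LogRecurrence : ℚ → PowerSeries → Set
LogRecurrence c E = ∀ n → fromℕ (suc n) * E (suc n) + fromℕ n * E n ≡ c * E n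

LogRecurrence-unique : ∀ c {E F} → LogRecurrence c E → LogRecurrence c F → E 0 ≡ F 0 → E ≐ F
LogRecurrence-unique c {E} {F} recE recF E₀≡F₀ = go
  where
  go : E ≐ F
  go zero = E₀≡F₀
  go (suc n) = fromℕ-suc-*-cancel n (begin
    fromℕ (suc n) * E (suc n)       ≡⟨ isolate (recE n) ⟩
    c * E n - fromℕ n * E n         ≡⟨ cong (λ x → c * x - fromℕ n * x) (go n) ⟩
    c * F n - fromℕ n * F n         ≡⟨ isolate (recF n) ⟨
    fromℕ (suc n) * F (suc n)       ∎)

∘ₚ-log-recurrence : ∀ a c → deriv a ≐ c ·ₚ a → LogRecurrence c (a ∘ₚ logCoeff)
∘ₚ-log-recurrence a c a′≐ca n = begin
  euler E (suc n) + euler E n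
    ≡⟨ cong₂ _+_ (euler-E (suc n)) (euler-E n) ⟩
  c * shift (sgn ⊛ E) (suc n) + c * shift (sgn ⊛ E) n
    ≡⟨ ℚ.*-distribˡ-+ c _ _ ⟨
  c * ((sgn ⊛ E) n + shift (sgn ⊛ E) n)
    ≡⟨ cong (c *_) (1+t-⊛ (sgn ⊛ E) n) ⟨
  c * (1+t ⊛ (sgn ⊛ E)) n
    ≡⟨ cong (c *_) (trans (sym (⊛-assoc 1+t sgn E n))
         (trans (⊛-cong 1+t-⊛-sgn (λ _ → refl) n) (⊛-identityˡ E n))) ⟩
  c * E n ∎
  where
  E : PowerSeries
  E = a ∘ₚ logCoeff
  euler-E : euler E ≐ c ·ₚ shift (sgn ⊛ E)
  euler-E m = trans (euler-∘ₚ refl a c a′≐ca m)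
    (cong (c *_) (trans (⊛-cong euler-log (λ _ → refl) m) (shift-⊛ sgn E m)))

expNeg : PowerSeries
expNeg k = sgn k * invFact k

exp∘log : invFact ∘ₚ logCoeff ≐ 1+t
exp∘log = LogRecurrence-unique 1ℚ
  (∘ₚ-log-recurrence invFact 1ℚ (λ j → trans (invFact-suc j) (sym (ℚ.*-identityˡ _))))
  1+t-recurrence refl
  where
  vanish : ∀ p q → p * 0ℚ + q * 0ℚ ≡ 1ℚ * 0ℚ
  vanish = solve-∀ ℚ-ring
  1+t-recurrence : LogRecurrence 1ℚ 1+t
  1+t-recurrence zero = refl
  1+t-recurrence (suc zero) = refl
  1+t-recurrence (suc (suc n)) = vanish (fromℕ (suc (suc (suc n)))) (fromℕ (suc (suc n)))

expNeg∘log : expNeg ∘ₚ logCoeff ≐ sgn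
expNeg∘log = LogRecurrence-unique (- 1ℚ)
  (∘ₚ-log-recurrence expNeg (- 1ℚ) deriv-expNeg) sgn-recurrence refl
  where
  deriv-expNeg : deriv expNeg ≐ (- 1ℚ) ·ₚ expNeg
  deriv-expNeg j = trans (reassoc (sgn j) (invFact (suc j)) (fromℕ (suc j)))
    (cong (λ x → (- 1ℚ) * (sgn j * x)) (invFact-suc j))
    where
    reassoc : ∀ s f q → (- s) * f * q ≡ (- 1ℚ) * (s * (f * q))
    reassoc = solve-∀ ℚ-ring
  sgn-recurrence : LogRecurrence (- 1ℚ) sgn
  sgn-recurrence n = trans (cong (λ q → q * (- sgn n) + fromℕ n * sgn n) (fromℕ-suc n)) (telescope (fromℕ n) (sgn n))
    where
    telescope : ∀ q s → (q + 1ℚ) * (- s) + q * s ≡ (- 1ℚ) * s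
    telescope = solve-∀ ℚ-ring

sgn-parity : ∀ k → sgn k ≡ (if isOdd k then - 1ℚ else 1ℚ)
sgn-parity zero = refl
sgn-parity (suc k) with isOdd k | sgn-parity k
... | true  | sgn≡ = cong -_ sgn≡
... | false | sgn≡ = cong -_ sgn≡

sinhCoeff-split : sinhCoeff ≐ ½ ·ₚ invFact +ₚ (- ½) ·ₚ expNeg
sinhCoeff-split k rewrite sgn-parity k with isOdd k
... | true  = sym (odd (invFact k))
  where
  odd : ∀ f → ½ * f + (- ½) * ((- 1ℚ) * f) ≡ f
  odd = solve-∀ ℚ-ring
... | false = sym (even (invFact k))
  where
  even : ∀ f → ½ * f + (- ½) * (1ℚ * f) ≡ 0ℚ
  even = solve-∀ ℚ-ring

coshCoeff-split : coshCoeff ≐ ½ ·ₚ invFact +ₚ ½ ·ₚ expNeg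
coshCoeff-split k rewrite sgn-parity k with isOdd k
... | true  = sym (odd (invFact k))
  where
  odd : ∀ f → ½ * f + ½ * ((- 1ℚ) * f) ≡ 0ℚ
  odd = solve-∀ ℚ-ring
... | false = sym (even (invFact k))
  where
  even : ∀ f → ½ * f + ½ * (1ℚ * f) ≡ f
  even = solve-∀ ℚ-ring

sinhLog coshLog : PowerSeries
sinhLog = sinhCoeff ∘ₚ logCoeff
coshLog = coshCoeff ∘ₚ logCoeff

sinhLog-closed : sinhLog ≐ ½ ·ₚ 1+t +ₚ (- ½) ·ₚ sgn
sinhLog-closed n = trans (∘ₚ-cong logCoeff sinhCoeff-split n)
  (trans (∘ₚ-linear ½ (- ½) invFact expNeg logCoeff n)
    (cong₂ (λ e e′ → ½ * e + (- ½) * e′) (exp∘log n) (expNeg∘log n)))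

coshLog-closed : coshLog ≐ ½ ·ₚ 1+t +ₚ ½ ·ₚ sgn
coshLog-closed n = trans (∘ₚ-cong logCoeff coshCoeff-split n)
  (trans (∘ₚ-linear ½ ½ invFact expNeg logCoeff n)
    (cong₂ (λ e e′ → ½ * e + ½ * e′) (exp∘log n) (expNeg∘log n)))

composeUpTo-sgn-inverse : ∀ G N → (1ₚ +ₚ G) ⊛ composeUpTo N sgn G ≐ 1ₚ +ₚ sgn N ·ₚ G ^ₚ suc N
composeUpTo-sgn-inverse G zero n = begin
  ((1ₚ +ₚ G) ⊛ (1ℚ ·ₚ 1ₚ)) n    ≡⟨ ⊛-·ʳ 1ℚ (1ₚ +ₚ G) 1ₚ n ⟩
  1ℚ * ((1ₚ +ₚ G) ⊛ 1ₚ) n       ≡⟨ cong (1ℚ *_) (⊛-identityʳ (1ₚ +ₚ G) n) ⟩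
  1ℚ * (1ₚ n + G n)             ≡⟨ cong (λ x → 1ℚ * (1ₚ n + x)) (⊛-identityʳ G n) ⟨
  1ℚ * (1ₚ n + (G ⊛ 1ₚ) n)      ≡⟨ unit (1ₚ n) _ ⟩
  1ₚ n + 1ℚ * (G ⊛ 1ₚ) n        ∎
  where
  unit : ∀ o g → 1ℚ * (o + g) ≡ o + 1ℚ * g
  unit = solve-∀ ℚ-ring
composeUpTo-sgn-inverse G (suc N) n = begin
  ((1ₚ +ₚ G) ⊛ (composeUpTo N sgn G +ₚ sgn (suc N) ·ₚ G ^ₚ suc N)) n
    ≡⟨ ⊛-distribˡ (1ₚ +ₚ G) (composeUpTo N sgn G) (sgn (suc N) ·ₚ G ^ₚ suc N) n ⟩
  ((1ₚ +ₚ G) ⊛ composeUpTo N sgn G) n + ((1ₚ +ₚ G) ⊛ (sgn (suc N) ·ₚ G ^ₚ suc N)) n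
    ≡⟨ cong₂ _+_ (composeUpTo-sgn-inverse G N n) (trans (⊛-·ʳ (sgn (suc N)) (1ₚ +ₚ G) (G ^ₚ suc N) n)
         (cong (sgn (suc N) *_) (trans (⊛-distribʳ 1ₚ G (G ^ₚ suc N) n)
           (cong (_+ (G ^ₚ suc (suc N)) n) (⊛-identityˡ (G ^ₚ suc N) n))))) ⟩
  (1ₚ n + sgn N * (G ^ₚ suc N) n) + (- sgn N) * ((G ^ₚ suc N) n + (G ^ₚ suc (suc N)) n)
    ≡⟨ telescope (1ₚ n) (sgn N) _ _ ⟩
  1ₚ n + (- sgn N) * (G ^ₚ suc (suc N)) n ∎
  where
  telescope : ∀ o s p q → (o + s * p) + (- s) * (p + q) ≡ o + (- s) * q
  telescope = solve-∀ ℚ-ring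

∘ₚ-sgn-inverse : ∀ G → G 0 ≡ 0ℚ → (1ₚ +ₚ G) ⊛ (sgn ∘ₚ G) ≐ 1ₚ
∘ₚ-sgn-inverse G G₀≡0 n = begin
  ((1ₚ +ₚ G) ⊛ (sgn ∘ₚ G)) n
    ≡⟨ ⊛-congʳ-≤ n (λ p p≤n → composeUpTo-stable G₀≡0 sgn n p p≤n) ⟨
  ((1ₚ +ₚ G) ⊛ composeUpTo n sgn G) n
    ≡⟨ composeUpTo-sgn-inverse G n n ⟩
  1ₚ n + sgn n * (G ^ₚ suc n) n
    ≡⟨ cong (λ x → 1ₚ n + sgn n * x) (^ₚ-vanishes G₀≡0 (suc n) n ℕ.≤-refl) ⟩
  1ₚ n + sgn n * 0ℚ
    ≡⟨ cong (1ₚ n +_) (ℚ.*-zeroʳ (sgn n)) ⟩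
  1ₚ n + 0ℚ
    ≡⟨ ℚ.+-identityʳ (1ₚ n) ⟩
  1ₚ n ∎

sechLog tanhLog : PowerSeries
sechLog = sgn ∘ₚ (λ n → coshLog n - 1ₚ n)
tanhLog = sinhLog ⊛ sechLog

coshLog-⊛-sechLog : coshLog ⊛ sechLog ≐ 1ₚ
coshLog-⊛-sechLog n = trans (⊛-cong (λ k → split (coshLog k) (1ₚ k)) (λ _ → refl) n)
  (∘ₚ-sgn-inverse (λ k → coshLog k - 1ₚ k) refl n)
  where
  split : ∀ c o → c ≡ o + (c - o)
  split = solve-∀ ℚ-ring

-- (1+t) cosh(log(1+t)) = ((1+t)² + 1)/2 and (1+t) sinh(log(1+t)) = ((1+t)² − 1)/2.
denominator numerator : PowerSeries
denominator zero = 1ℚ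
denominator (suc zero) = 1ℚ
denominator (suc (suc zero)) = ½
denominator (suc (suc (suc _))) = 0ℚ
numerator zero = 0ℚ
numerator (suc zero) = 1ℚ
numerator (suc (suc zero)) = ½
numerator (suc (suc (suc _))) = 0ℚ

1+t-⊛-coshLog : 1+t ⊛ coshLog ≐ denominator
1+t-⊛-coshLog zero = refl
1+t-⊛-coshLog (suc n) = trans (1+t-⊛ coshLog (suc n))
  (trans (cong₂ _+_ (coshLog-closed (suc n)) (coshLog-closed n)) (evaluate n))
  where
  cancel : ∀ h s → h * 0ℚ + h * (- s) + (h * 0ℚ + h * s) ≡ 0ℚ
  cancel = solve-∀ ℚ-ring
  evaluate : ∀ n → ½ * 1+t (suc n) + ½ * sgn (suc n) + (½ * 1+t n + ½ * sgn n) ≡ denominator (suc n)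
  evaluate zero = refl
  evaluate (suc zero) = refl
  evaluate (suc (suc k)) = cancel ½ (sgn (suc (suc k)))

1+t-⊛-sinhLog : 1+t ⊛ sinhLog ≐ numerator
1+t-⊛-sinhLog zero = refl
1+t-⊛-sinhLog (suc n) = trans (1+t-⊛ sinhLog (suc n))
  (trans (cong₂ _+_ (sinhLog-closed (suc n)) (sinhLog-closed n)) (evaluate n))
  where
  cancel : ∀ h s → h * 0ℚ + (- h) * (- s) + (h * 0ℚ + (- h) * s) ≡ 0ℚ
  cancel = solve-∀ ℚ-ring
  evaluate : ∀ n → ½ * 1+t (suc n) + (- ½) * sgn (suc n) + (½ * 1+t n + (- ½) * sgn n) ≡ numerator (suc n)
  evaluate zero = refl
  evaluate (suc zero) = refl
  evaluate (suc (suc k)) = cancel ½ (sgn (suc (suc k)))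

denominator-⊛-tanhLog : denominator ⊛ tanhLog ≐ numerator
denominator-⊛-tanhLog n = begin
  (denominator ⊛ tanhLog) n             ≡⟨ ⊛-cong 1+t-⊛-coshLog (λ _ → refl) n ⟨
  ((1+t ⊛ coshLog) ⊛ tanhLog) n         ≡⟨ ⊛-assoc 1+t coshLog tanhLog n ⟩
  (1+t ⊛ (coshLog ⊛ tanhLog)) n         ≡⟨ ⊛-cong (λ _ → refl) coshLog-⊛-tanhLog n ⟩
  (1+t ⊛ sinhLog) n                     ≡⟨ 1+t-⊛-sinhLog n ⟩
  numerator n                           ∎
  where
  coshLog-⊛-tanhLog : coshLog ⊛ tanhLog ≐ sinhLog
  coshLog-⊛-tanhLog m = begin
    (coshLog ⊛ (sinhLog ⊛ sechLog)) m   ≡⟨ ⊛-assoc coshLog sinhLog sechLog m ⟨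
    ((coshLog ⊛ sinhLog) ⊛ sechLog) m   ≡⟨ ⊛-cong (⊛-comm coshLog sinhLog) (λ _ → refl) m ⟩
    ((sinhLog ⊛ coshLog) ⊛ sechLog) m   ≡⟨ ⊛-assoc sinhLog coshLog sechLog m ⟩
    (sinhLog ⊛ (coshLog ⊛ sechLog)) m   ≡⟨ ⊛-cong (λ _ → refl) coshLog-⊛-sechLog m ⟩
    (sinhLog ⊛ 1ₚ) m                    ≡⟨ ⊛-identityʳ sinhLog m ⟩
    sinhLog m                           ∎

denominator-⊛ : ∀ H n → (denominator ⊛ H) (suc (suc n)) ≡ H (suc (suc n)) + (H (suc n) + ½ * H n)
denominator-⊛ H n =
  cong₂ _+_ (ℚ.*-identityˡ (H (suc (suc n)))) (cong₂ _+_ (ℚ.*-identityˡ (H (suc n))) (quadratic-term n))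
  where
  quadratic-term : ∀ n → (tail (tail denominator) ⊛ H) n ≡ ½ * H n
  quadratic-term zero = refl
  quadratic-term (suc m) = trans (cong (½ * H (suc m) +_) (⊛-zeroˡ H (λ _ → refl) m)) (ℚ.+-identityʳ _)

tanhLog-recurrence : ∀ n → tanhLog (suc (suc n)) + (tanhLog (suc n) + ½ * tanhLog n) ≡ numerator (suc (suc n))
tanhLog-recurrence n = trans (sym (denominator-⊛ tanhLog n)) (denominator-⊛-tanhLog (suc (suc n)))

tanhLog-0 : tanhLog 0 ≡ 0ℚ
tanhLog-0 = trans (sym (ℚ.*-identityˡ (tanhLog 0))) (denominator-⊛-tanhLog 0)

tanhLog-1 : tanhLog 1 ≡ 1ℚ
tanhLog-1 = begin
  tanhLog 1                            ≡⟨ unit (tanhLog 1) ⟨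
  1ℚ * tanhLog 1 + 1ℚ * 0ℚ             ≡⟨ cong (λ x → 1ℚ * tanhLog 1 + 1ℚ * x) tanhLog-0 ⟨
  (denominator ⊛ tanhLog) 1            ≡⟨ denominator-⊛-tanhLog 1 ⟩
  1ℚ                                   ∎
  where
  unit : ∀ y → 1ℚ * y + 1ℚ * 0ℚ ≡ y
  unit = solve-∀ ℚ-ring

-- The closed form

*G-assoc : ∀ z w v → (z *G w) *G v ≡ z *G (w *G v)
*G-assoc (a +i b) (c +i d) (e +i f) = cong₂ _+i_ (re-assoc a b c d e f) (im-assoc a b c d e f)
  where
  re-assoc : ∀ a b c d e f → (a ℤ.* c ℤ.- b ℤ.* d) ℤ.* e ℤ.- (a ℤ.* d ℤ.+ b ℤ.* c) ℤ.* f
                           ≡ a ℤ.* (c ℤ.* e ℤ.- d ℤ.* f) ℤ.- b ℤ.* (c ℤ.* f ℤ.+ d ℤ.* e)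
  re-assoc = ℤ-Solver.solve-∀
  im-assoc : ∀ a b c d e f → (a ℤ.* c ℤ.- b ℤ.* d) ℤ.* f ℤ.+ (a ℤ.* d ℤ.+ b ℤ.* c) ℤ.* e
                           ≡ a ℤ.* (c ℤ.* f ℤ.+ d ℤ.* e) ℤ.+ b ℤ.* (c ℤ.* e ℤ.- d ℤ.* f)
  im-assoc = ℤ-Solver.solve-∀

*G-comm : ∀ z w → z *G w ≡ w *G z
*G-comm (a +i b) (c +i d) = cong₂ _+i_ (re-comm a b c d) (im-comm a b c d)
  where
  re-comm : ∀ a b c d → a ℤ.* c ℤ.- b ℤ.* d ≡ c ℤ.* a ℤ.- d ℤ.* b
  re-comm = ℤ-Solver.solve-∀
  im-comm : ∀ a b c d → a ℤ.* d ℤ.+ b ℤ.* c ≡ c ℤ.* b ℤ.+ d ℤ.* a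
  im-comm = ℤ-Solver.solve-∀

re-i* : ∀ z → re (iG *G z) ≡ ℤ.- im z
re-i* (a +i b) = rotate a b
  where
  rotate : ∀ a b → ℤ.+ 0 ℤ.* a ℤ.- ℤ.+ 1 ℤ.* b ≡ ℤ.- b
  rotate = ℤ-Solver.solve-∀

im-i* : ∀ z → im (iG *G z) ≡ re z
im-i* (a +i b) = rotate a b
  where
  rotate : ∀ a b → ℤ.+ 0 ℤ.* b ℤ.+ ℤ.+ 1 ℤ.* a ≡ a
  rotate = ℤ-Solver.solve-∀

re-1+i* : ∀ z → re (1+iG *G z) ≡ re z ℤ.- im z
re-1+i* (a +i b) = expand a b
  where
  expand : ∀ a b → ℤ.+ 1 ℤ.* a ℤ.- ℤ.+ 1 ℤ.* b ≡ a ℤ.- b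
  expand = ℤ-Solver.solve-∀

im-1+i* : ∀ z → im (1+iG *G z) ≡ re z ℤ.+ im z
im-1+i* (a +i b) = expand a b
  where
  expand : ∀ a b → ℤ.+ 1 ℤ.* b ℤ.+ ℤ.+ 1 ℤ.* a ≡ a ℤ.+ b
  expand = ℤ-Solver.solve-∀

-- ReCoeff n m unfolds to fromℤ (re (W n m)).
W : ℕ → ℕ → ℤ[i]
W n m = (iG ^G m) *G (1+iG ^G suc n)

W-suc-m : ∀ n m → W n (suc m) ≡ iG *G W n m
W-suc-m n m = *G-assoc iG (iG ^G m) (1+iG ^G suc n)

W-suc-n : ∀ n m → W (suc n) m ≡ 1+iG *G W n m
W-suc-n n m = begin
  (iG ^G m) *G (1+iG *G (1+iG ^G suc n))   ≡⟨ *G-assoc (iG ^G m) 1+iG (1+iG ^G suc n) ⟨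
  ((iG ^G m) *G 1+iG) *G (1+iG ^G suc n)   ≡⟨ cong (_*G (1+iG ^G suc n)) (*G-comm (iG ^G m) 1+iG) ⟩
  (1+iG *G (iG ^G m)) *G (1+iG ^G suc n)   ≡⟨ *G-assoc 1+iG (iG ^G m) (1+iG ^G suc n) ⟩
  1+iG *G W n m                            ∎

re-W-suc-suc : ∀ n m → re (W (suc n) (suc m)) ≡ ℤ.- (re (W n m) ℤ.+ im (W n m))
re-W-suc-suc n m = begin
  re (W (suc n) (suc m))              ≡⟨ cong re (W-suc-m (suc n) m) ⟩
  re (iG *G W (suc n) m)              ≡⟨ re-i* (W (suc n) m) ⟩
  ℤ.- im (W (suc n) m)                ≡⟨ cong (λ z → ℤ.- im z) (W-suc-n n m) ⟩
  ℤ.- im (1+iG *G W n m)              ≡⟨ cong ℤ.-_ (im-1+i* (W n m)) ⟩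
  ℤ.- (re (W n m) ℤ.+ im (W n m))     ∎

im-W-suc-suc : ∀ n m → im (W (suc n) (suc m)) ≡ re (W n m) ℤ.- im (W n m)
im-W-suc-suc n m = begin
  im (W (suc n) (suc m))              ≡⟨ cong im (W-suc-m (suc n) m) ⟩
  im (iG *G W (suc n) m)              ≡⟨ im-i* (W (suc n) m) ⟩
  re (W (suc n) m)                    ≡⟨ cong re (W-suc-n n m) ⟩
  re (1+iG *G W n m)                  ≡⟨ re-1+i* (W n m) ⟩
  re (W n m) ℤ.- im (W n m)           ∎

re-W-pascal : ∀ n m → re (W (suc n) m) ≡ ℤ.+ 2 ℤ.* re (W n m) ℤ.+ re (W (suc n) (suc m))
re-W-pascal n m = begin
  re (W (suc n) m)
    ≡⟨ cong re (W-suc-n n m) ⟩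
  re (1+iG *G W n m)
    ≡⟨ re-1+i* (W n m) ⟩
  re (W n m) ℤ.- im (W n m)
    ≡⟨ pascal (re (W n m)) (im (W n m)) ⟩
  ℤ.+ 2 ℤ.* re (W n m) ℤ.+ ℤ.- (re (W n m) ℤ.+ im (W n m))
    ≡⟨ cong (λ x → ℤ.+ 2 ℤ.* re (W n m) ℤ.+ x) (re-W-suc-suc n m) ⟨
  ℤ.+ 2 ℤ.* re (W n m) ℤ.+ re (W (suc n) (suc m)) ∎
  where
  pascal : ∀ a b → a ℤ.- b ≡ ℤ.+ 2 ℤ.* a ℤ.+ ℤ.- (a ℤ.+ b)
  pascal = ℤ-Solver.solve-∀

re-W-diagonal : ∀ k → re (W (suc (suc k)) (suc (suc k)))
                      ℤ.+ (ℤ.+ 2 ℤ.* re (W (suc k) (suc k)) ℤ.+ ℤ.+ 2 ℤ.* re (W k k)) ≡ ℤ.+ 0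
re-W-diagonal k = begin
  re (W (suc (suc k)) (suc (suc k))) ℤ.+ (ℤ.+ 2 ℤ.* r₁ ℤ.+ ℤ.+ 2 ℤ.* a)
    ≡⟨ cong (λ x → x ℤ.+ (ℤ.+ 2 ℤ.* r₁ ℤ.+ ℤ.+ 2 ℤ.* a)) (re-W-suc-suc (suc k) (suc k)) ⟩
  ℤ.- (r₁ ℤ.+ im (W (suc k) (suc k))) ℤ.+ (ℤ.+ 2 ℤ.* r₁ ℤ.+ ℤ.+ 2 ℤ.* a)
    ≡⟨ cong₂ (λ r i → ℤ.- (r ℤ.+ i) ℤ.+ (ℤ.+ 2 ℤ.* r ℤ.+ ℤ.+ 2 ℤ.* a))
             (re-W-suc-suc k k) (im-W-suc-suc k k) ⟩
  ℤ.- (ℤ.- (a ℤ.+ b) ℤ.+ (a ℤ.- b)) ℤ.+ (ℤ.+ 2 ℤ.* ℤ.- (a ℤ.+ b) ℤ.+ ℤ.+ 2 ℤ.* a)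
    ≡⟨ cancel a b ⟩
  ℤ.+ 0 ∎
  where
  a b r₁ : ℤ
  a = re (W k k)
  b = im (W k k)
  r₁ = re (W (suc k) (suc k))
  cancel : ∀ a b → ℤ.- (ℤ.- (a ℤ.+ b) ℤ.+ (a ℤ.- b)) ℤ.+ (ℤ.+ 2 ℤ.* ℤ.- (a ℤ.+ b) ℤ.+ ℤ.+ 2 ℤ.* a)
                 ≡ ℤ.+ 0
  cancel = ℤ-Solver.solve-∀

closedForm : ℕ → ℕ → ℚ
closedForm n m = (- inv2^ n) * ReCoeff n m

closedForm-pascal : ∀ n m → closedForm (suc n) m ≡ closedForm n m + closedForm (suc n) (suc m)
closedForm-pascal n m = begin
  (- h) * fromℤ (re (W (suc n) m))
    ≡⟨ cong (λ x → (- h) * fromℤ x) (re-W-pascal n m) ⟩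
  (- h) * fromℤ (ℤ.+ 2 ℤ.* a ℤ.+ b)
    ≡⟨ cong ((- h) *_) (trans (fromℤ-+ (ℤ.+ 2 ℤ.* a) b) (cong (_+ fromℤ b) (fromℤ-* (ℤ.+ 2) a))) ⟩
  (- h) * (fromℕ 2 * fromℤ a + fromℤ b)
    ≡⟨ distrib h (fromℕ 2) (fromℤ a) (fromℤ b) ⟩
  (- (h * fromℕ 2)) * fromℤ a + (- h) * fromℤ b
    ≡⟨ cong (λ x → (- x) * fromℤ a + (- h) * fromℤ b) (inv2^-suc n) ⟩
  closedForm n m + closedForm (suc n) (suc m) ∎
  where
  h : ℚ
  h = inv2^ (suc n)
  a b : ℤ
  a = re (W n m)
  b = re (W (suc n) (suc m))
  distrib : ∀ h c x y → (- h) * (c * x + y) ≡ (- (h * c)) * x + (- h) * y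
  distrib = solve-∀ ℚ-ring

closedForm-diagonal : ∀ k → closedForm (suc (suc k)) (suc (suc k))
                            + (closedForm (suc k) (suc k) + ½ * closedForm k k) ≡ 0ℚ
closedForm-diagonal k = begin
  (- h) * fromℤ r₂ + ((- inv2^ (suc k)) * fromℤ r₁ + ½ * ((- inv2^ k) * fromℤ a))
    ≡⟨ cong₂ (λ x y → (- h) * fromℤ r₂ + ((- x) * fromℤ r₁ + ½ * ((- y) * fromℤ a))) halve quarter ⟩
  (- h) * fromℤ r₂ + ((- (h * fromℕ 2)) * fromℤ r₁ + ½ * ((- (h * fromℕ 2 * fromℕ 2)) * fromℤ a))
    ≡⟨ collect h (fromℤ r₂) (fromℤ r₁) (fromℤ a) ⟩
  (- h) * (fromℤ r₂ + (fromℕ 2 * fromℤ r₁ + fromℕ 2 * fromℤ a))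
    ≡⟨ cong ((- h) *_) cast ⟨
  (- h) * fromℤ (r₂ ℤ.+ (ℤ.+ 2 ℤ.* r₁ ℤ.+ ℤ.+ 2 ℤ.* a))
    ≡⟨ cong (λ x → (- h) * fromℤ x) (re-W-diagonal k) ⟩
  (- h) * 0ℚ
    ≡⟨ ℚ.*-zeroʳ (- h) ⟩
  0ℚ ∎
  where
  h : ℚ
  h = inv2^ (suc (suc k))
  a r₁ r₂ : ℤ
  a = re (W k k)
  r₁ = re (W (suc k) (suc k))
  r₂ = re (W (suc (suc k)) (suc (suc k)))
  halve : inv2^ (suc k) ≡ h * fromℕ 2
  halve = sym (inv2^-suc (suc k))
  quarter : inv2^ k ≡ h * fromℕ 2 * fromℕ 2
  quarter = sym (trans (cong (_* fromℕ 2) (inv2^-suc (suc k))) (inv2^-suc k))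
  cast : fromℤ (r₂ ℤ.+ (ℤ.+ 2 ℤ.* r₁ ℤ.+ ℤ.+ 2 ℤ.* a)) ≡ fromℤ r₂ + (fromℕ 2 * fromℤ r₁ + fromℕ 2 * fromℤ a)
  cast = trans (fromℤ-+ r₂ _) (cong (_+_ (fromℤ r₂))
    (trans (fromℤ-+ (ℤ.+ 2 ℤ.* r₁) (ℤ.+ 2 ℤ.* a)) (cong₂ _+_ (fromℤ-* (ℤ.+ 2) r₁) (fromℤ-* (ℤ.+ 2) a))))
  collect : ∀ h x y z → (- h) * x + ((- (h * fromℕ 2)) * y + ½ * ((- (h * fromℕ 2 * fromℕ 2)) * z))
                      ≡ (- h) * (x + (fromℕ 2 * y + fromℕ 2 * z))
  collect = solve-∀ ℚ-ring

SecondOrder : PowerSeries → Set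
SecondOrder x = ∀ k → x (suc (suc k)) + (x (suc k) + ½ * x k) ≡ 0ℚ

SecondOrder-unique : ∀ {x y} → SecondOrder x → SecondOrder y → x 0 ≡ y 0 → x 1 ≡ y 1 → x ≐ y
SecondOrder-unique {x} {y} recx recy x₀≡y₀ x₁≡y₁ k = proj₁ (go k)
  where
  go : ∀ k → x k ≡ y k × x (suc k) ≡ y (suc k)
  go zero = x₀≡y₀ , x₁≡y₁
  go (suc k) with go k
  ... | xₖ≡yₖ , xₖ₊₁≡yₖ₊₁ = xₖ₊₁≡yₖ₊₁ , (begin
    x (suc (suc k))                   ≡⟨ isolate (recx k) ⟩
    0ℚ - (x (suc k) + ½ * x k)        ≡⟨ cong₂ (λ a b → 0ℚ - (a + ½ * b)) xₖ₊₁≡yₖ₊₁ xₖ≡yₖ ⟩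
    0ℚ - (y (suc k) + ½ * y k)        ≡⟨ isolate (recy k) ⟨
    y (suc (suc k))                   ∎)

tanhLog-diagonal : ∀ k → tanhLog (suc k) ≡ closedForm (suc k) (suc k)
tanhLog-diagonal = SecondOrder-unique (λ k → tanhLog-recurrence (suc k))
  (λ k → closedForm-diagonal (suc k)) tanhLog-1 tanhLog-2
  where
  tanhLog-2 : tanhLog 2 ≡ - ½
  tanhLog-2 = trans (isolate {b = tanhLog 1 + ½ * tanhLog 0} (tanhLog-recurrence 0))
    (cong₂ (λ a b → ½ - (a + ½ * b)) tanhLog-1 tanhLog-0)

-- binomialSum d y m = Σ_j C(d, j) y (m + j)
binomialSum : ℕ → PowerSeries → PowerSeries
binomialSum zero y m = y m
binomialSum (suc d) y m = binomialSum d y m + binomialSum d y (suc m)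

binomialSum-tail : ∀ d y m → binomialSum d (tail y) m ≡ binomialSum d y (suc m)
binomialSum-tail zero y m = refl
binomialSum-tail (suc d) y m = cong₂ _+_ (binomialSum-tail d y m) (binomialSum-tail d y (suc m))

binomialSum-tanhLog : ∀ d m → binomialSum d tanhLog (suc m) ≡ closedForm (d ℕ.+ suc m) (suc m)
binomialSum-tanhLog zero m = tanhLog-diagonal m
binomialSum-tanhLog (suc d) m = begin
  binomialSum d tanhLog (suc m) + binomialSum d tanhLog (suc (suc m))
    ≡⟨ cong₂ _+_ (binomialSum-tanhLog d m) (binomialSum-tanhLog d (suc m)) ⟩
  closedForm (d ℕ.+ suc m) (suc m) + closedForm (d ℕ.+ suc (suc m)) (suc (suc m))
    ≡⟨ cong (λ N → closedForm (d ℕ.+ suc m) (suc m) + closedForm N (suc (suc m))) (ℕ.+-suc d (suc m)) ⟩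
  closedForm (d ℕ.+ suc m) (suc m) + closedForm (suc d ℕ.+ suc m) (suc (suc m))
    ≡⟨ closedForm-pascal (d ℕ.+ suc m) (suc m) ⟨
  closedForm (suc d ℕ.+ suc m) (suc m) ∎

-- A composition of n of length m has C(n − m, j) refinements of length m + j, so this is
-- Σ_(I refines J) y (length I) for every composition J of n of length m.
finerSum : ℕ → PowerSeries → PowerSeries
finerSum n y m = binomialSum (n ∸ m) y m

finerSum-tanhLog : ∀ n m → 1 ≤ m → m ≤ n → finerSum n tanhLog m ≡ closedForm n m
finerSum-tanhLog n (suc m) _ m<n =
  trans (binomialSum-tanhLog (n ∸ suc m) m) (cong (λ N → closedForm N (suc m)) (ℕ.m∸n+n≡m m<n))

-- Series whose coefficients depend only on the length of the word

sumℚ-map-cong : ∀ {A : Set} {f g : A → ℚ} → (∀ x → f x ≡ g x) →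
                ∀ xs → sumℚ (map f xs) ≡ sumℚ (map g xs)
sumℚ-map-cong f≗g xs = cong sumℚ (map-cong f≗g xs)

byLength : PowerSeries → Series
byLength F w = F (length w)

*S-byLength : ∀ F G → byLength F *S byLength G ≈ byLength (F ⊛ G)
*S-byLength F G [] = ℚ.+-identityʳ (F 0 * G 0)
*S-byLength F G (a ∷ w) = cong (F 0 * G (suc (length w)) +_)
  (trans (cong sumℚ (sym (map-∘ (splits w)))) (*S-byLength (tail F) G w))

*S-cong : ∀ {f f′ g g′} → f ≈ f′ → g ≈ g′ → f *S g ≈ f′ *S g′
*S-cong f≈f′ g≈g′ w = sumℚ-map-cong (λ { (u , v) → cong₂ _*_ (f≈f′ u) (g≈g′ v) }) (splits w)

oneS≈byLength-1ₚ : oneS ≈ byLength 1ₚ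
oneS≈byLength-1ₚ [] = refl
oneS≈byLength-1ₚ (_ ∷ _) = refl

^S-byLength : ∀ {x F} → x ≈ byLength F → ∀ k → x ^S k ≈ byLength (F ^ₚ k)
^S-byLength x≈F zero = oneS≈byLength-1ₚ
^S-byLength {F = F} x≈F (suc k) w = trans (*S-cong x≈F (^S-byLength x≈F k) w) (*S-byLength F (F ^ₚ k) w)

subst-series-byLength : ∀ a {x F} → x ≈ byLength F → subst-series a x ≈ byLength (a ∘ₚ F)
subst-series-byLength a x≈F w = sumUpTo-cong (length w) (λ k → cong (a k *_) (^S-byLength x≈F k w))

σ₁-1≈byLength-t : σ₁ -S oneS ≈ byLength t
σ₁-1≈byLength-t [] = refl
σ₁-1≈byLength-t (_ ∷ []) = refl
σ₁-1≈byLength-t (_ ∷ _ ∷ _) = refl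

φ≈byLength-log : φ ≈ byLength logCoeff
φ≈byLength-log w = trans (subst-series-byLength logCoeff σ₁-1≈byLength-t w) (∘ₚ-t logCoeff (length w))

Y≈byLength-tanhLog : Y ≈ byLength tanhLog
Y≈byLength-tanhLog w = trans (*S-cong sinhφ≈ coshφ⁻¹≈ w) (*S-byLength sinhLog sechLog w)
  where
  sinhφ≈ : sinhφ ≈ byLength sinhLog
  sinhφ≈ = subst-series-byLength sinhCoeff φ≈byLength-log
  coshφ-1≈ : coshφ -S oneS ≈ byLength (λ n → coshLog n - 1ₚ n)
  coshφ-1≈ w = cong₂ _-_ (subst-series-byLength coshCoeff φ≈byLength-log w) (oneS≈byLength-1ₚ w)
  coshφ⁻¹≈ : coshφ⁻¹ ≈ byLength sechLog
  coshφ⁻¹≈ = subst-series-byLength invCoeff coshφ-1≈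

-- Sums over compositions and coarsenings

sumℚ-++ : ∀ {A : Set} (f : A → ℚ) xs ys → sumℚ (map f (xs ++ ys)) ≡ sumℚ (map f xs) + sumℚ (map f ys)
sumℚ-++ f [] ys = sym (ℚ.+-identityˡ _)
sumℚ-++ f (x ∷ xs) ys = trans (cong (f x +_) (sumℚ-++ f xs ys)) (sym (ℚ.+-assoc (f x) _ _))

sumℚ-concatMap : ∀ {A B : Set} (f : B → ℚ) (g : A → List B) xs →
                 sumℚ (map f (concatMap g xs)) ≡ sumℚ (map (λ x → sumℚ (map f (g x))) xs)
sumℚ-concatMap f g [] = refl
sumℚ-concatMap f g (x ∷ xs) = trans (sumℚ-++ f (g x) (concatMap g xs))
  (cong (sumℚ (map f (g x)) +_) (sumℚ-concatMap f g xs))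

sumℚ-+ : ∀ {A : Set} (f g : A → ℚ) xs → sumℚ (map (λ x → f x + g x) xs) ≡ sumℚ (map f xs) + sumℚ (map g xs)
sumℚ-+ f g [] = refl
sumℚ-+ f g (x ∷ xs) = trans (cong (f x + g x +_) (sumℚ-+ f g xs)) (interchange (f x) (g x) _ _)
  where
  interchange : ∀ a b c d → a + b + (c + d) ≡ a + c + (b + d)
  interchange = solve-∀ ℚ-ring

*-sumℚ : ∀ {A : Set} c (f : A → ℚ) xs → c * sumℚ (map f xs) ≡ sumℚ (map (λ x → c * f x) xs)
*-sumℚ c f [] = ℚ.*-zeroʳ c
*-sumℚ c f (x ∷ xs) = trans (ℚ.*-distribˡ-+ c (f x) _) (cong (c * f x +_) (*-sumℚ c f xs))

sumℚ-* : ∀ {A : Set} (f : A → ℚ) c xs → sumℚ (map f xs) * c ≡ sumℚ (map (λ x → f x * c) xs)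
sumℚ-* f c [] = ℚ.*-zeroˡ c
sumℚ-* f c (x ∷ xs) = trans (ℚ.*-distribʳ-+ c (f x) _) (cong (f x * c +_) (sumℚ-* f c xs))

sumℚ-zero : ∀ {A : Set} (f : A → ℚ) → (∀ x → f x ≡ 0ℚ) → ∀ xs → sumℚ (map f xs) ≡ 0ℚ
sumℚ-zero f f≡0 [] = refl
sumℚ-zero f f≡0 (x ∷ xs) = cong₂ _+_ (f≡0 x) (sumℚ-zero f f≡0 xs)

sumℚ-comm : ∀ {A B : Set} (f : A → B → ℚ) xs ys →
            sumℚ (map (λ x → sumℚ (map (f x) ys)) xs) ≡ sumℚ (map (λ y → sumℚ (map (λ x → f x y) xs)) ys)
sumℚ-comm f [] ys = sym (sumℚ-zero _ (λ _ → refl) ys)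
sumℚ-comm f (x ∷ xs) ys = trans (cong (sumℚ (map (f x) ys) +_) (sumℚ-comm f xs ys))
  (sym (sumℚ-+ (f x) (λ y → sumℚ (map (λ x → f x y) xs)) ys))

bumpHead : (Word → ℚ) → Word → ℚ
bumpHead ρ [] = 0ℚ
bumpHead ρ (a ∷ J) = ρ (suc a ∷ J)

sumCompositions : ℕ → (Word → ℚ) → ℚ
sumCompositions n f = sumℚ (map f (compositions n))

sumCompositions-suc : ∀ n f →
  sumCompositions (suc n) f ≡ sumCompositions n (λ I → f (0 ∷ I)) + sumCompositions n (bumpHead f)
sumCompositions-suc n f = trans (sumℚ-++ f (map (0 ∷_) (compositions n)) _)
  (cong₂ _+_ (cong sumℚ (sym (map-∘ (compositions n))))
    (trans (sumℚ-concatMap f _ (compositions n))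
      (sumℚ-map-cong (λ { [] → refl ; (a ∷ I) → ℚ.+-identityʳ _ }) (compositions n))))

sumCoarsenings : Word → (Word → ℚ) → ℚ
sumCoarsenings I ρ = sumℚ (map ρ (coarsenings I))

sumCoarsenings-0∷ : ∀ I ρ → sumCoarsenings (0 ∷ I) ρ ≡ sumCoarsenings I (λ J → ρ (0 ∷ J) + bumpHead ρ J)
sumCoarsenings-0∷ I ρ = trans (sumℚ-concatMap ρ _ (coarsenings I))
  (sumℚ-map-cong (λ { [] → refl ; (j ∷ J) → cong (ρ (0 ∷ j ∷ J) +_) (ℚ.+-identityʳ _) }) (coarsenings I))

sumCoarsenings-suc∷ : ∀ a I ρ → sumCoarsenings (suc a ∷ I) ρ ≡ sumCoarsenings (a ∷ I) (bumpHead ρ)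
sumCoarsenings-suc∷ a I ρ = trans (sumℚ-concatMap ρ _ (coarsenings I))
  (trans (sumℚ-map-cong (λ { [] → refl ; (j ∷ J) → refl }) (coarsenings I))
    (sym (sumℚ-concatMap (bumpHead ρ) _ (coarsenings I))))

weighted : ℕ → (ℕ → ℚ) → (Word → ℚ) → ℚ
weighted n e ρ = sumCompositions n (λ J → e (length J) * ρ J)

coarseWeighted : ℕ → (ℕ → ℚ) → (Word → ℚ) → ℚ
coarseWeighted n y ρ = sumCompositions n (λ I → y (length I) * sumCoarsenings I ρ)

weighted-suc : ∀ n e ρ → weighted (suc n) e ρ ≡ weighted n (tail e) (λ J → ρ (0 ∷ J)) + weighted n e (bumpHead ρ)
weighted-suc n e ρ = trans (sumCompositions-suc n _)
  (cong (weighted n (tail e) (λ J → ρ (0 ∷ J)) +_)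
    (sumℚ-map-cong (λ { [] → sym (ℚ.*-zeroʳ (e 0)) ; (a ∷ J) → refl }) (compositions n)))

coarseWeighted-suc : ∀ n y ρ → coarseWeighted (suc n) y ρ
  ≡ coarseWeighted n (tail y) (λ J → ρ (0 ∷ J) + bumpHead ρ J) + coarseWeighted n y (bumpHead ρ)
coarseWeighted-suc n y ρ = trans (sumCompositions-suc n _)
  (cong₂ _+_ (sumℚ-map-cong (λ I → cong (y (suc (length I)) *_) (sumCoarsenings-0∷ I ρ)) (compositions n))
    (sumℚ-map-cong (λ { [] → sym (ℚ.*-zeroʳ (y 0))
                      ; (a ∷ I) → cong (y (suc (length I)) *_) (sumCoarsenings-suc∷ a I ρ) })
                   (compositions n)))

weighted-+ʳ : ∀ n e ρ ρ′ → weighted n e (λ J → ρ J + ρ′ J) ≡ weighted n e ρ + weighted n e ρ′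
weighted-+ʳ n e ρ ρ′ =
  trans (sumℚ-map-cong (λ J → ℚ.*-distribˡ-+ (e (length J)) (ρ J) (ρ′ J)) (compositions n))
  (sumℚ-+ (λ J → e (length J) * ρ J) (λ J → e (length J) * ρ′ J) (compositions n))

weighted-+ˡ : ∀ n e e′ ρ → weighted n (λ m → e m + e′ m) ρ ≡ weighted n e ρ + weighted n e′ ρ
weighted-+ˡ n e e′ ρ =
  trans (sumℚ-map-cong (λ J → ℚ.*-distribʳ-+ (ρ J) (e (length J)) (e′ (length J))) (compositions n))
  (sumℚ-+ (λ J → e (length J) * ρ J) (λ J → e′ (length J) * ρ J) (compositions n))

weighted-cong-≤ : ∀ n {e e′} ρ → (∀ m → m ≤ n → e m ≡ e′ m) → weighted n e ρ ≡ weighted n e′ ρ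
weighted-cong-≤ zero ρ e≡e′ = cong (λ x → x * ρ [] + 0ℚ) (e≡e′ 0 z≤n)
weighted-cong-≤ (suc n) {e} {e′} ρ e≡e′ = begin
  weighted (suc n) e ρ
    ≡⟨ weighted-suc n e ρ ⟩
  weighted n (tail e) (λ J → ρ (0 ∷ J)) + weighted n e (bumpHead ρ)
    ≡⟨ cong₂ _+_ (weighted-cong-≤ n _ (λ m m≤n → e≡e′ (suc m) (s≤s m≤n)))
                  (weighted-cong-≤ n (bumpHead ρ) (λ m m≤n → e≡e′ m (ℕ.m≤n⇒m≤1+n m≤n))) ⟩
  weighted n (tail e′) (λ J → ρ (0 ∷ J)) + weighted n e′ (bumpHead ρ)
    ≡⟨ weighted-suc n e′ ρ ⟨
  weighted (suc n) e′ ρ ∎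

weighted-cong-nonempty : ∀ n {e e′} ρ → ρ [] ≡ 0ℚ → (∀ m → 1 ≤ m → m ≤ n → e m ≡ e′ m) →
                         weighted n e ρ ≡ weighted n e′ ρ
weighted-cong-suc : ∀ n {e e′} ρ → (∀ m → 1 ≤ m → m ≤ suc n → e m ≡ e′ m) →
                    weighted (suc n) e ρ ≡ weighted (suc n) e′ ρ

weighted-cong-nonempty zero {e} {e′} ρ ρ[]≡0 _ = cong (_+ 0ℚ) (begin
  e 0 * ρ []     ≡⟨ cong (e 0 *_) ρ[]≡0 ⟩
  e 0 * 0ℚ       ≡⟨ trans (ℚ.*-zeroʳ (e 0)) (sym (ℚ.*-zeroʳ (e′ 0))) ⟩
  e′ 0 * 0ℚ      ≡⟨ cong (e′ 0 *_) ρ[]≡0 ⟨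
  e′ 0 * ρ []    ∎)
weighted-cong-nonempty (suc n) ρ _ e≡e′ = weighted-cong-suc n ρ e≡e′

weighted-cong-suc n {e} {e′} ρ e≡e′ = begin
  weighted (suc n) e ρ
    ≡⟨ weighted-suc n e ρ ⟩
  weighted n (tail e) (λ J → ρ (0 ∷ J)) + weighted n e (bumpHead ρ)
    ≡⟨ cong₂ _+_ (weighted-cong-≤ n _ (λ m m≤n → e≡e′ (suc m) (s≤s z≤n) (s≤s m≤n)))
                  (weighted-cong-nonempty n (bumpHead ρ) refl
                    (λ m 1≤m m≤n → e≡e′ m 1≤m (ℕ.m≤n⇒m≤1+n m≤n))) ⟩
  weighted n (tail e′) (λ J → ρ (0 ∷ J)) + weighted n e′ (bumpHead ρ)
    ≡⟨ weighted-suc n e′ ρ ⟨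
  weighted (suc n) e′ ρ ∎

coarseWeighted≡weighted-finerSum : ∀ n y ρ → coarseWeighted n y ρ ≡ weighted n (finerSum n y) ρ
coarseWeighted≡weighted-finerSum zero y ρ = cong (λ x → y 0 * x + 0ℚ) (ℚ.+-identityʳ (ρ []))
coarseWeighted≡weighted-finerSum (suc n) y ρ = begin
  coarseWeighted (suc n) y ρ
    ≡⟨ coarseWeighted-suc n y ρ ⟩
  coarseWeighted n (tail y) (λ J → ρ₀ J + bumpHead ρ J) + coarseWeighted n y (bumpHead ρ)
    ≡⟨ cong₂ _+_ (coarseWeighted≡weighted-finerSum n (tail y) _)
                 (coarseWeighted≡weighted-finerSum n y (bumpHead ρ)) ⟩
  weighted n A (λ J → ρ₀ J + bumpHead ρ J) + weighted n B (bumpHead ρ)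
    ≡⟨ cong (_+ weighted n B (bumpHead ρ)) (weighted-+ʳ n A ρ₀ (bumpHead ρ)) ⟩
  weighted n A ρ₀ + weighted n A (bumpHead ρ) + weighted n B (bumpHead ρ)
    ≡⟨ ℚ.+-assoc (weighted n A ρ₀) _ _ ⟩
  weighted n A ρ₀ + (weighted n A (bumpHead ρ) + weighted n B (bumpHead ρ))
    ≡⟨ cong (weighted n A ρ₀ +_) (weighted-+ˡ n A B (bumpHead ρ)) ⟨
  weighted n A ρ₀ + weighted n (λ m → A m + B m) (bumpHead ρ)
    ≡⟨ cong₂ _+_ (weighted-cong-≤ n ρ₀ (λ m _ → finerSum-tail m))
                 (weighted-cong-≤ n (bumpHead ρ) finerSum-suc) ⟩
  weighted n (tail (finerSum (suc n) y)) ρ₀ + weighted n (finerSum (suc n) y) (bumpHead ρ)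
    ≡⟨ weighted-suc n (finerSum (suc n) y) ρ ⟨
  weighted (suc n) (finerSum (suc n) y) ρ ∎
  where
  A B : ℕ → ℚ
  A = finerSum n (tail y)
  B = finerSum n y
  ρ₀ : Word → ℚ
  ρ₀ J = ρ (0 ∷ J)
  finerSum-tail : ∀ m → finerSum n (tail y) m ≡ finerSum (suc n) y (suc m)
  finerSum-tail m = binomialSum-tail (n ∸ m) y m
  finerSum-suc : ∀ m → m ≤ n → finerSum n (tail y) m + finerSum n y m ≡ finerSum (suc n) y m
  finerSum-suc m m≤n = begin
    binomialSum (n ∸ m) (tail y) m + binomialSum (n ∸ m) y m
      ≡⟨ cong (_+ binomialSum (n ∸ m) y m) (binomialSum-tail (n ∸ m) y m) ⟩
    binomialSum (n ∸ m) y (suc m) + binomialSum (n ∸ m) y m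
      ≡⟨ ℚ.+-comm (binomialSum (n ∸ m) y (suc m)) _ ⟩
    binomialSum (suc (n ∸ m)) y m
      ≡⟨ cong (λ d → binomialSum d y m) (ℕ.+-∸-assoc 1 m≤n) ⟨
    binomialSum (suc n ∸ m) y m ∎

-- The ribbon expansion of Y_n

S^-diagonal : ∀ I → S^ I I ≡ 1ℚ
S^-diagonal I with ≡-dec ℕ._≟_ I I
... | yes _ = refl
... | no I≢I = ⊥-elim (I≢I refl)

S^-off-diagonal : ∀ I w → ¬ I ≡ w → S^ I w ≡ 0ℚ
S^-off-diagonal I w I≢w with ≡-dec ℕ._≟_ I w
... | yes I≡w = ⊥-elim (I≢w I≡w)
... | no _ = refl

S^-image : ∀ (f : Word → Word) → (∀ {I w} → f I ≡ f w → I ≡ w) → ∀ I w → S^ (f I) (f w) ≡ S^ I w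
S^-image f f-injective I w with ≡-dec ℕ._≟_ I w
... | yes refl = S^-diagonal (f I)
... | no I≢w = S^-off-diagonal (f I) (f w) (I≢w ∘ f-injective)

sucHead : Word → Word
sucHead [] = []
sucHead (a ∷ I) = suc a ∷ I

sucHead-injective : ∀ {I w} → sucHead I ≡ sucHead w → I ≡ w
sucHead-injective {[]} {[]} _ = refl
sucHead-injective {_ ∷ _} {_ ∷ _} refl = refl

sumCompositions-S^ : ∀ n (c : Word → ℚ) w →
  sumCompositions n (λ I → c I * S^ I w) ≡ (if does (deg w ℕ.≟ n) then c w else 0ℚ)
sumCompositions-S^ zero c [] = trans (cong (λ x → c [] * x + 0ℚ) (S^-diagonal []))
  (trans (ℚ.+-identityʳ _) (ℚ.*-identityʳ (c [])))
sumCompositions-S^ zero c (a ∷ w) = trans (cong (λ x → c [] * x + 0ℚ) (S^-off-diagonal [] (a ∷ w) λ ()))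
  (trans (ℚ.+-identityʳ _) (ℚ.*-zeroʳ (c [])))
sumCompositions-S^ (suc n) c w = trans (sumCompositions-suc n (λ I → c I * S^ I w)) (by-first-letter w)
  where
  vanishes : ∀ I w → ¬ I ≡ w → c I * S^ I w ≡ 0ℚ
  vanishes I w I≢w = trans (cong (c I *_) (S^-off-diagonal I w I≢w)) (ℚ.*-zeroʳ (c I))
  by-first-letter : ∀ w → sumCompositions n (λ I → c (0 ∷ I) * S^ (0 ∷ I) w)
                          + sumCompositions n (bumpHead (λ I → c I * S^ I w))
                        ≡ (if does (deg w ℕ.≟ suc n) then c w else 0ℚ)
  by-first-letter [] = cong₂ _+_ (sumℚ-zero _ (λ I → vanishes (0 ∷ I) [] λ ()) (compositions n))
    (sumℚ-zero _ (λ { [] → refl ; (a ∷ I) → vanishes (suc a ∷ I) [] λ () }) (compositions n))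
  by-first-letter (zero ∷ w) = trans (cong₂ _+_
      (trans (sumℚ-map-cong (λ I → cong (c (0 ∷ I) *_) (S^-image (0 ∷_) ∷-injectiveʳ I w)) (compositions n))
        (sumCompositions-S^ n (λ I → c (0 ∷ I)) w))
      (sumℚ-zero _ (λ { [] → refl ; (a ∷ I) → vanishes (suc a ∷ I) (0 ∷ w) λ () }) (compositions n)))
    (ℚ.+-identityʳ _)
  by-first-letter (suc b ∷ w) = trans (cong₂ _+_
      (sumℚ-zero _ (λ I → vanishes (0 ∷ I) (suc b ∷ w) λ ()) (compositions n))
      (trans (sumℚ-map-cong (λ { [] → sym (ℚ.*-zeroˡ (S^ [] (b ∷ w)))
                               ; (a ∷ I) → cong (c (suc a ∷ I) *_)
                                               (S^-image sucHead sucHead-injective (a ∷ I) (b ∷ w)) })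
                            (compositions n))
        (sumCompositions-S^ n (bumpHead c) (b ∷ w))))
    (ℚ.+-identityˡ _)

sumS-apply : ∀ {A : Set} (F : A → Series) xs w → sumS (map F xs) w ≡ sumℚ (map (λ x → F x w) xs)
sumS-apply F [] w = refl
sumS-apply F (x ∷ xs) w = cong (F x w +_) (sumS-apply F xs w)

Yₙ≡coarseWeighted : ∀ R → IsRibbonBasis R → ∀ n w → Yₙ n w ≡ coarseWeighted n tanhLog (λ J → R J w)
Yₙ≡coarseWeighted R isRibbon n w = begin
  (if does (deg w ℕ.≟ n) then Y w else 0ℚ)
    ≡⟨ cong (λ x → if does (deg w ℕ.≟ n) then x else 0ℚ) (Y≈byLength-tanhLog w) ⟩
  (if does (deg w ℕ.≟ n) then tanhLog (length w) else 0ℚ)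
    ≡⟨ sumCompositions-S^ n (tanhLog ∘ length) w ⟨
  sumCompositions n (λ I → tanhLog (length I) * S^ I w)
    ≡⟨ sumℚ-map-cong (λ I → cong (tanhLog (length I) *_) (trans (isRibbon I w) (sumS-apply R (coarsenings I) w)))
                     (compositions n) ⟩
  coarseWeighted n tanhLog (λ J → R J w) ∎

indicator : Bool → ℚ
indicator b = if b then 1ℚ else 0ℚ

sumBelow : ℕ → (ℕ → ℚ) → ℚ
sumBelow zero h = 0ℚ
sumBelow (suc n) h = h 0 + sumBelow n (h ∘ suc)

sumℚ-applyUpTo : ∀ (g : ℕ → ℚ) f n → sumℚ (map g (applyUpTo f n)) ≡ sumBelow n (g ∘ f)
sumℚ-applyUpTo g f zero = refl
sumℚ-applyUpTo g f (suc n) = cong (g (f 0) +_) (sumℚ-applyUpTo g (f ∘ suc) n)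

sumBelow-zero : ∀ n h → (∀ r → h r ≡ 0ℚ) → sumBelow n h ≡ 0ℚ
sumBelow-zero zero h h≡0 = refl
sumBelow-zero (suc n) h h≡0 = cong₂ _+_ (h≡0 0) (sumBelow-zero n (h ∘ suc) (h≡0 ∘ suc))

sumBelow-indicator : ∀ n (c : ℕ → ℚ) m → 1 ≤ m → m ≤ n →
                     sumBelow n (λ r → c (suc r) * indicator (does (m ℕ.≟ suc r))) ≡ c m
sumBelow-indicator (suc n) c 1 _ _ =
  trans (cong₂ _+_ (ℚ.*-identityʳ (c 1)) (sumBelow-zero n _ (λ r → ℚ.*-zeroʳ (c (suc (suc r))))))
    (ℚ.+-identityʳ (c 1))
sumBelow-indicator (suc n) c (suc (suc m)) _ (s≤s m<n) =
  trans (cong₂ _+_ (ℚ.*-zeroʳ (c 1)) (sumBelow-indicator n (c ∘ suc) (suc m) (s≤s z≤n) m<n))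
    (ℚ.+-identityˡ (c (suc (suc m))))

rhsWeight : ℕ → ℕ → ℚ
rhsWeight n m = (- inv2^ n) * sumBelow n (λ r → ReCoeff n (suc r) * indicator (does (m ℕ.≟ suc r)))

rhsWeight-closedForm : ∀ n m → 1 ≤ m → m ≤ n → rhsWeight n m ≡ closedForm n m
rhsWeight-closedForm n m 1≤m m≤n = cong ((- inv2^ n) *_) (sumBelow-indicator n (ReCoeff n) m 1≤m m≤n)

*-weighted : ∀ c n e ρ → c * weighted n e ρ ≡ weighted n (λ m → c * e m) ρ
*-weighted c n e ρ = trans (*-sumℚ c _ (compositions n))
  (sumℚ-map-cong (λ J → sym (ℚ.*-assoc c (e (length J)) (ρ J))) (compositions n))

sumℚ-weighted : ∀ {A : Set} (e : A → ℕ → ℚ) xs n ρ →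
  sumℚ (map (λ x → weighted n (e x) ρ) xs) ≡ weighted n (λ m → sumℚ (map (λ x → e x m) xs)) ρ
sumℚ-weighted e xs n ρ = trans (sumℚ-comm (λ x J → e x (length J) * ρ J) xs (compositions n))
  (sumℚ-map-cong (λ J → sym (sumℚ-* (λ x → e x (length J)) (ρ J) xs)) (compositions n))

𝒜-weighted : ∀ R n r w → 𝒜 R n r w ≡ weighted n (λ m → indicator (does (m ℕ.≟ r))) (λ J → R J w)
𝒜-weighted R n r w = trans (sumS-apply _ (compositions n) w) (sumℚ-map-cong select (compositions n))
  where
  select : ∀ I → (if does (length I ℕ.≟ r) then R I else zeroS) w ≡ indicator (does (length I ℕ.≟ r)) * R I w
  select I with does (length I ℕ.≟ r)
  ... | true  = sym (ℚ.*-identityˡ (R I w))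
  ... | false = sym (ℚ.*-zeroˡ (R I w))

rhs≡weighted : ∀ R n w → rhs R n w ≡ weighted n (rhsWeight n) (λ J → R J w)
rhs≡weighted R n w = begin
  (- h) * sumS (map (λ r → ReCoeff n (suc r) ·S 𝒜 R n (suc r)) (upTo n)) w
    ≡⟨ cong ((- h) *_) (trans (sumS-apply _ (upTo n) w) (sumℚ-map-cong term-weighted (upTo n))) ⟩
  (- h) * sumℚ (map (λ r → weighted n (term r) ρ) (upTo n))
    ≡⟨ cong ((- h) *_) (sumℚ-weighted term (upTo n) n ρ) ⟩
  (- h) * weighted n (λ m → sumℚ (map (λ r → term r m) (upTo n))) ρ
    ≡⟨ *-weighted (- h) n (λ m → sumℚ (map (λ r → term r m) (upTo n))) ρ ⟩
  weighted n (λ m → (- h) * sumℚ (map (λ r → term r m) (upTo n))) ρ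
    ≡⟨ weighted-cong-≤ n ρ (λ m _ → cong ((- h) *_) (sumℚ-applyUpTo (λ r → term r m) (λ r → r) n)) ⟩
  weighted n (rhsWeight n) ρ ∎
  where
  h : ℚ
  h = inv2^ n
  ρ : Word → ℚ
  ρ J = R J w
  term : ℕ → ℕ → ℚ
  term r m = ReCoeff n (suc r) * indicator (does (m ℕ.≟ suc r))
  term-weighted : ∀ r → ReCoeff n (suc r) * 𝒜 R n (suc r) w ≡ weighted n (term r) ρ
  term-weighted r = trans (cong (ReCoeff n (suc r) *_) (𝒜-weighted R n (suc r) w))
    (*-weighted (ReCoeff n (suc r)) n (λ m → indicator (does (m ℕ.≟ suc r))) ρ)

mainTheorem2 : (R : Word → Series) → IsRibbonBasis R →
               (n : ℕ) → 1 ≤ n → Yₙ n ≈ rhs R n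
mainTheorem2 R isRibbon n@(suc n-1) _ w = begin
  Yₙ n w                                 ≡⟨ Yₙ≡coarseWeighted R isRibbon n w ⟩
  coarseWeighted n tanhLog ρ             ≡⟨ coarseWeighted≡weighted-finerSum n tanhLog ρ ⟩
  weighted n (finerSum n tanhLog) ρ      ≡⟨ weighted-cong-suc n-1 ρ finerSum≡rhsWeight ⟩
  weighted n (rhsWeight n) ρ             ≡⟨ rhs≡weighted R n w ⟨
  rhs R n w                              ∎
  where
  ρ : Word → ℚ
  ρ J = R J w
  finerSum≡rhsWeight : ∀ m → 1 ≤ m → m ≤ n → finerSum n tanhLog m ≡ rhsWeight n m
  finerSum≡rhsWeight m 1≤m m≤n = trans (finerSum-tanhLog n m 1≤m m≤n) (sym (rhsWeight-closedForm n m 1≤m m≤n))
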